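{- Let $r,s\ge 5$ be integers. Then $P_r \,\square\, P_s$ has exactly one edge general position set of maximum cardinality.
   Context: $P_n$ is the path on $n$ vertices. The Cartesian product $G\,\square\, H$ has vertex set $V(G)\times V(H)$, with $(g,h)$ adjacent to $(g',h')$ iff either $gg'\in E(G)$ and $h=h'$, or $g=g'$ and $hh'\in E(H)$. A geodesic is a shortest path. A set $S$ of edges of a graph $G$ is an edge general position set if no geodesic of $G$ contains three edges of $S$. -}

module Defs where

open import Data.Nat using (ℕ; suc; _≤_)
open import Data.Fin using (Fin; toℕ; _≟_)
open import Data.Product using (Σ; _×_; _,_; ∃-syntax; proj₁; proj₂)
open import Data.Sum using (_⊎_)
open import Data.Maybe using (Maybe; just)
open import Data.List using (List; []; _∷_; length; head; last; lookup)
open import Data.List.Relation.Unary.All using (All)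
open import Data.List.Relation.Unary.Any using (Any)
open import Data.List.Relation.Unary.AllPairs using (AllPairs)
open import Relation.Binary.PropositionalEquality using (_≡_)
open import Relation.Nullary using (¬_)
open import Function.Bundles using (_⇔_)

record Graph : Set₁ where
  field
    V   : Set
    Adj : V → V → Set
open Graph public

P : ℕ → Graph
P n = record { V = Fin n ; Adj = λ i j → (suc (toℕ i) ≡ toℕ j) ⊎ (suc (toℕ j) ≡ toℕ i) }

_□_ : Graph → Graph → Graph
G □ H = record
  { V = V G × V H
  ; Adj = λ { (g , h) (g' , h') → (Adj G g g' × h ≡ h') ⊎ (g ≡ g' × Adj H h h') } }

module _ (G : Graph) where
  private
    W = V G
    A = Adj G

  steps : List W → List (W × W)
  steps []           = []
  steps (a ∷ [])     = []
  steps (a ∷ b ∷ t)  = (a , b) ∷ steps (b ∷ t)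

  IsWalk : W → W → List W → Set
  IsWalk u v p = (head p ≡ just u) × (last p ≡ just v) × All (λ e → A (proj₁ e) (proj₂ e)) (steps p)

  IsGeodesic : List W → Set
  IsGeodesic p = Σ W λ u → Σ W λ v → IsWalk u v p × (∀ q → IsWalk u v q → length p ≤ length q)

  -- an edge is represented by an (ordered) pair of adjacent vertices;
  -- two pairs denote the same (unordered) edge iff they agree up to swapping
  _≈ₑ_ : W × W → W × W → Set
  (a , b) ≈ₑ (c , d) = (a ≡ c × b ≡ d) ⊎ (a ≡ d × b ≡ c)

  -- a finite set of edges of G: a duplicate-free list of edges
  IsEdgeSet : List (W × W) → Set
  IsEdgeSet S = All (λ e → A (proj₁ e) (proj₂ e)) S × AllPairs (λ e f → ¬ (e ≈ₑ f)) S

  _OnWalk_ : W × W → List W → Set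
  e OnWalk p = Any (λ f → e ≈ₑ f) (steps p)

  IsEdgeGP : List (W × W) → Set
  IsEdgeGP S = ∀ p → IsGeodesic p → ¬ (Σ (Fin (length S)) λ i → Σ (Fin (length S)) λ j → Σ (Fin (length S)) λ k →
      ¬ (i ≡ j) × ¬ (j ≡ k) × ¬ (i ≡ k) ×
      (lookup S i OnWalk p) × (lookup S j OnWalk p) × (lookup S k OnWalk p))

  _∈ₑ_ : W × W → List (W × W) → Set
  e ∈ₑ S = Any (λ f → e ≈ₑ f) S

  IsMaxEdgeGP : List (W × W) → Set
  IsMaxEdgeGP S = IsEdgeSet S × IsEdgeGP S ×
    (∀ T → IsEdgeSet T → IsEdgeGP T → length T ≤ length S)

  UniqueMaxEdgeGP : Set
  UniqueMaxEdgeGP = Σ (List (W × W)) λ S → IsMaxEdgeGP S ×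
    (∀ T → IsMaxEdgeGP T → ∀ e → (e ∈ₑ T) ⇔ (e ∈ₑ S))

{-# OPTIONS --safe #-}
-- Write the grid as {0, …, R + 1} × {0, …, S + 1}. A geodesic is a walk whose length is the Manhattan
-- distance, so it is monotone in both coordinates. Every row and column is a geodesic, hence carries at
-- most two edges of an edge general position set T; and if a row carries edges of T at columns a < b,
-- then no column c ≤ a or c > b carries a vertical edge of T, because a geodesic turning from that column
-- into the row would collect three (dually for columns). Counting rows and columns gives |T| ≤ 2R + 2S,
-- with equality only if every inner row and column carries exactly its two spokes, the edges joining it
-- to the frame. Conversely the 2R + 2S spokes are in general position: of three spokes on a monotone
-- walk, the middle one would touch the frame between two that do not.
module Submission where

open import Defs
open import Data.Empty using (⊥; ⊥-elim)
open import Data.Fin using (Fin; toℕ) renaming (zero to fz; suc to fs)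
open import Data.Fin.Properties using (toℕ-injective; toℕ<n)
open import Data.List using (List; []; _∷_; length; last; lookup; _++_; drop; applyUpTo)
open import Data.List.Membership.Propositional using (_∈_; find; lose)
open import Data.List.Membership.Propositional.Properties using (∈-lookup; ∈-applyUpTo⁺; ∈-applyUpTo⁻; ∈-++⁻; ∈-++⁺ˡ; ∈-++⁺ʳ)
open import Data.List.Properties using (length-++; length-applyUpTo)
open import Data.List.Relation.Unary.All as All using (All; []; _∷_)
import Data.List.Relation.Unary.All.Properties as Allₚ
open import Data.List.Relation.Unary.AllPairs as AllPairs using (AllPairs; []; _∷_)
import Data.List.Relation.Unary.AllPairs.Properties as AllPairsₚ
open import Data.List.Relation.Unary.Any as Any using (Any; here; there; index)
import Data.List.Relation.Unary.Any.Properties as Anyₚ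
open import Data.Maybe using (just)
open import Data.Nat using (ℕ; zero; suc; _+_; _*_; _∸_; _≤_; _<_; _≤?_; _≟_; z≤n; s≤s; ∣_-_∣)
open import Data.Nat.Properties
open import Algebra.Properties.CommutativeSemigroup +-commutativeSemigroup using (interchange; xy∙z≈xz∙y; xy∙z≈yx∙z)
open import Data.Product using (Σ; _×_; _,_; proj₁; proj₂)
open import Data.Sum as Sum using (_⊎_; inj₁; inj₂; [_,_]′)
open import Function using (_∘_)
open import Function.Bundles using (_⇔_; mk⇔)
open import Relation.Binary.Definitions using (tri<; tri≈; tri>)
open import Relation.Binary.PropositionalEquality
open import Relation.Nullary using (¬_; yes; no)
open import Relation.Nullary.Decidable using (_×-dec_)
open import Relation.Unary using (Decidable)

n≢1+n : ∀ n → n ≢ suc n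
n≢1+n n = m≢1+n+m n {0}

n≢2+n : ∀ n → n ≢ suc (suc n)
n≢2+n n = m≢1+n+m n {1}

m+m≡n+n⇒m≡n : ∀ m n → m + m ≡ n + n → m ≡ n
m+m≡n+n⇒m≡n m n eq = *-cancelˡ-≡ m n 2 (begin
  2 * m        ≡⟨ cong (m +_) (+-identityʳ m) ⟩
  m + m        ≡⟨ eq ⟩
  n + n        ≡⟨ cong (n +_) (+-identityʳ n) ⟨
  2 * n        ∎)
  where open ≡-Reasoning

m+m≢1+n+n : ∀ m n → m + m ≢ suc (n + n)
m+m≢1+n+n m n eq = even≢odd m n (begin
  2 * m          ≡⟨ cong (m +_) (+-identityʳ m) ⟩
  m + m          ≡⟨ eq ⟩
  suc (n + n)    ≡⟨ cong (λ k → suc (n + k)) (+-identityʳ n) ⟨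
  suc (2 * n)    ∎)
  where open ≡-Reasoning

∣n-1+n∣≡1 : ∀ n → ∣ n - suc n ∣ ≡ 1
∣n-1+n∣≡1 zero    = refl
∣n-1+n∣≡1 (suc n) = ∣n-1+n∣≡1 n

∣1+n-n∣≡1 : ∀ n → ∣ suc n - n ∣ ≡ 1
∣1+n-n∣≡1 n = trans (∣-∣-comm (suc n) n) (∣n-1+n∣≡1 n)

Between : ℕ → ℕ → ℕ → Set
Between a b c = (a ≤ b × b ≤ c) ⊎ (c ≤ b × b ≤ a)

StepBetween : ℕ → ℕ → ℕ → Set
StepBetween t a c = (a ≤ t × suc t ≤ c) ⊎ (c ≤ t × suc t ≤ a)

between-refl : ∀ a c → Between a a c
between-refl a c with ≤-total a c
... | inj₁ a≤c = inj₁ (≤-refl , a≤c)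
... | inj₂ c≤a = inj₂ (c≤a , ≤-refl)

between-end : ∀ a c → Between a c c
between-end a c with ≤-total a c
... | inj₁ a≤c = inj₁ (a≤c , ≤-refl)
... | inj₂ c≤a = inj₂ (≤-refl , c≤a)

∣-∣-between : ∀ a b c → Between a b c → ∣ a - b ∣ + ∣ b - c ∣ ≡ ∣ a - c ∣
∣-∣-between a b c (inj₁ (a≤b , b≤c))
  rewrite m≤n⇒∣m-n∣≡n∸m a≤b | m≤n⇒∣m-n∣≡n∸m b≤c | m≤n⇒∣m-n∣≡n∸m (≤-trans a≤b b≤c) =
  trans (+-comm (b ∸ a) (c ∸ b)) (trans (sym (+-∸-assoc (c ∸ b) a≤b)) (cong (_∸ a) (m∸n+n≡m b≤c)))
∣-∣-between a b c (inj₂ (c≤b , b≤a))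
  rewrite m≤n⇒∣n-m∣≡n∸m b≤a | m≤n⇒∣n-m∣≡n∸m c≤b | m≤n⇒∣n-m∣≡n∸m (≤-trans c≤b b≤a) =
  trans (sym (+-∸-assoc (a ∸ b) c≤b)) (cong (_∸ c) (m∸n+n≡m b≤a))

step-towards : ∀ a b c → (suc a ≡ b ⊎ suc b ≡ a) → ∣ a - c ∣ ≡ suc ∣ b - c ∣ → Between a b c
step-towards a .(suc a) c (inj₁ refl) eq = inj₁ (n≤1+n a , up a c eq)
  where
  up : ∀ a c → ∣ a - c ∣ ≡ suc ∣ suc a - c ∣ → suc a ≤ c
  up zero    (suc c) eq = s≤s z≤n
  up (suc a) zero    eq = ⊥-elim (n≢2+n a (suc-injective eq))
  up (suc a) (suc c) eq = s≤s (up a c eq)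
step-towards .(suc b) b c (inj₂ refl) eq = inj₂ (down b c eq , n≤1+n b)
  where
  down : ∀ b c → ∣ suc b - c ∣ ≡ suc ∣ b - c ∣ → c ≤ b
  down b       zero    eq = z≤n
  down zero    (suc c) eq = ⊥-elim (n≢2+n c eq)
  down (suc b) (suc c) eq = s≤s (down b c eq)

between-from-below : ∀ {a b c} → a ≤ c → Between a b c → a ≤ b × b ≤ c
between-from-below a≤c (inj₁ q) = q
between-from-below a≤c (inj₂ (c≤b , b≤a)) = ≤-trans a≤c c≤b , ≤-trans b≤a a≤c

between-from-above : ∀ {a b c} → c ≤ a → Between a b c → b ≤ a × c ≤ b
between-from-above c≤a (inj₂ (c≤b , b≤a)) = b≤a , c≤b
between-from-above c≤a (inj₁ (a≤b , b≤c)) = ≤-trans b≤c c≤a , ≤-trans c≤a a≤b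

far-end : ∀ t c → Σ ℕ λ x → x ≤ suc t × StepBetween t c x × c ≢ x
far-end t c with ≤-<-connex c t
... | inj₁ c≤t = suc t , ≤-refl , inj₁ (c≤t , ≤-refl) , <⇒≢ (s≤s c≤t)
... | inj₂ t<c = t , n≤1+n t , inj₂ (≤-refl , t<c) , ≢-sym (<⇒≢ t<c)

beyond-both : ∀ {a b c} → a < b → c ≤ a ⊎ b < c → Σ ℕ λ y → y ≤ suc b × StepBetween a c y × StepBetween b c y
beyond-both {a} {b} a<b (inj₁ c≤a) = suc b , ≤-refl , inj₁ (c≤a , s≤s (<⇒≤ a<b)) , inj₁ (≤-trans c≤a (<⇒≤ a<b) , ≤-refl)
beyond-both {a} {b} a<b (inj₂ b<c) = a , ≤-trans (<⇒≤ a<b) (n≤1+n b) , inj₂ (≤-refl , <-trans a<b b<c) , inj₂ (<⇒≤ a<b , b<c)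

outside⊎inside : ∀ x a b → (x ≤ a ⊎ b < x) ⊎ (a < x × x ≤ b)
outside⊎inside x a b with x ≤? a | suc b ≤? x
... | yes x≤a | _     = inj₁ (inj₁ x≤a)
... | no _    | yes b<x = inj₁ (inj₂ b<x)
... | no x≰a  | no b≮x  = inj₂ (≰⇒> x≰a , ≤-pred (≰⇒> b≮x))

∑< : ℕ → (ℕ → ℕ) → ℕ
∑< zero    f = 0
∑< (suc n) f = ∑< n f + f n

∑<-cong : ∀ n {f g} → (∀ k → k < n → f k ≡ g k) → ∑< n f ≡ ∑< n g
∑<-cong zero    f≡g = refl
∑<-cong (suc n) f≡g = cong₂ _+_ (∑<-cong n (λ k k<n → f≡g k (m<n⇒m<1+n k<n))) (f≡g n ≤-refl)

∑<-mono-≤ : ∀ n {f g} → (∀ k → k < n → f k ≤ g k) → ∑< n f ≤ ∑< n g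
∑<-mono-≤ zero    f≤g = z≤n
∑<-mono-≤ (suc n) f≤g = +-mono-≤ (∑<-mono-≤ n (λ k k<n → f≤g k (m<n⇒m<1+n k<n))) (f≤g n ≤-refl)

∑<-+ : ∀ n f g → ∑< n (λ k → f k + g k) ≡ ∑< n f + ∑< n g
∑<-+ zero    f g = refl
∑<-+ (suc n) f g = trans (cong (_+ (f n + g n)) (∑<-+ n f g)) (interchange (∑< n f) (∑< n g) (f n) (g n))

∑<-const : ∀ n b → ∑< n (λ _ → b) ≡ n * b
∑<-const zero    b = refl
∑<-const (suc n) b = trans (cong (_+ b) (∑<-const n b)) (+-comm (n * b) b)

∑<-≤-* : ∀ n b {f} → (∀ k → k < n → f k ≤ b) → ∑< n f ≤ n * b
∑<-≤-* n b f≤b = ≤-trans (∑<-mono-≤ n f≤b) (≤-reflexive (∑<-const n b))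

∑<-+-gaps : ∀ n b {f} → (∀ k → k < n → f k ≤ b) → ∑< n f + ∑< n (λ k → b ∸ f k) ≡ n * b
∑<-+-gaps n b {f} f≤b = begin
  ∑< n f + ∑< n (λ k → b ∸ f k)  ≡⟨ ∑<-+ n f (λ k → b ∸ f k) ⟨
  ∑< n (λ k → f k + (b ∸ f k))   ≡⟨ ∑<-cong n (λ k k<n → m+[n∸m]≡n (f≤b k k<n)) ⟩
  ∑< n (λ _ → b)                 ≡⟨ ∑<-const n b ⟩
  n * b                          ∎
  where open ≡-Reasoning

∑<-≥-term : ∀ n f {j} → j < n → f j ≤ ∑< n f
∑<-≥-term (suc n) f {j} j<1+n with m≤n⇒m<n∨m≡n (≤-pred j<1+n)
... | inj₂ refl = m≤n+m (f j) (∑< j f)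
... | inj₁ j<n  = ≤-trans (∑<-≥-term n f j<n) (m≤m+n (∑< n f) (f n))

∑<-≥-two-terms : ∀ n f {j j′} → j < j′ → j′ < n → f j + f j′ ≤ ∑< n f
∑<-≥-two-terms (suc n) f {j} {j′} j<j′ j′<1+n with m≤n⇒m<n∨m≡n (≤-pred j′<1+n)
... | inj₂ refl = +-monoˡ-≤ (f j′) (∑<-≥-term j′ f j<j′)
... | inj₁ j′<n = ≤-trans (∑<-≥-two-terms n f j<j′ j′<n) (m≤m+n (∑< n f) (f n))

∑<-≥-three-terms : ∀ n f {j j′ j″} → j < j′ → j′ < j″ → j″ < n → f j + f j′ + f j″ ≤ ∑< n f
∑<-≥-three-terms (suc n) f {j″ = j″} j<j′ j′<j″ j″<1+n with m≤n⇒m<n∨m≡n (≤-pred j″<1+n)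
... | inj₂ refl = +-monoˡ-≤ (f j″) (∑<-≥-two-terms j″ f j<j′ j′<j″)
... | inj₁ j″<n = ≤-trans (∑<-≥-three-terms n f j<j′ j′<j″ j″<n) (m≤m+n (∑< n f) (f n))

∑<-positive : ∀ n f → 1 ≤ ∑< n f → Σ ℕ λ k → k < n × 1 ≤ f k
∑<-positive (suc n) f pos with f n in eq
... | suc _ = n , ≤-refl , subst (1 ≤_) (sym eq) (s≤s z≤n)
... | zero with ∑<-positive n f (≤-trans pos (≤-reflexive (+-identityʳ (∑< n f))))
...   | k , k<n , fk = k , m<n⇒m<1+n k<n , fk

all≤1⊎some≥2 : ∀ n (f : ℕ → ℕ) → (∀ k → k < n → f k ≤ 1) ⊎ (Σ ℕ λ k → k < n × 2 ≤ f k)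
all≤1⊎some≥2 zero    f = inj₁ (λ k ())
all≤1⊎some≥2 (suc n) f with all≤1⊎some≥2 n f | 2 ≤? f n
... | inj₂ (k , k<n , fk) | _     = inj₂ (k , m<n⇒m<1+n k<n , fk)
... | inj₁ all≤1          | yes q = inj₂ (n , ≤-refl , q)
... | inj₁ all≤1          | no q  =
  inj₁ λ k k<1+n → [ all≤1 k , (λ { refl → ≤-pred (≰⇒> q) }) ]′ (m≤n⇒m<n∨m≡n (≤-pred k<1+n))

module _ (n b : ℕ) {f : ℕ → ℕ} (f≤b : ∀ k → k < n → f k ≤ b) where

  private
    gaps : ℕ
    gaps = ∑< n (λ k → b ∸ f k)

    gap-≤ : ∀ {x} → x ≤ gaps → ∑< n f + x ≤ n * b
    gap-≤ {x} x≤gaps = ≤-trans (+-monoʳ-≤ (∑< n f) x≤gaps) (≤-reflexive (∑<-+-gaps n b f≤b))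

  ∑<+b≤n*b : ∀ {j} → j < n → f j ≡ 0 → ∑< n f + b ≤ n * b
  ∑<+b≤n*b {j} j<n fj≡0 = gap-≤ (subst (λ x → b ∸ x ≤ gaps) fj≡0 (∑<-≥-term n (λ k → b ∸ f k) j<n))

  ∑<+b+b≤n*b : ∀ {j j′} → j < j′ → j′ < n → f j ≡ 0 → f j′ ≡ 0 → ∑< n f + (b + b) ≤ n * b
  ∑<+b+b≤n*b {j} {j′} j<j′ j′<n fj≡0 fj′≡0 =
    gap-≤ (subst₂ (λ x y → b ∸ x + (b ∸ y) ≤ gaps) fj≡0 fj′≡0 (∑<-≥-two-terms n (λ k → b ∸ f k) j<j′ j′<n))

  ∑<+b+1+b≤n*b : ∀ {j j′ j″} → j < j′ → j′ < j″ → j″ < n → f j ≡ 0 → f j′ < b → f j″ ≡ 0 →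
                 ∑< n f + (b + 1 + b) ≤ n * b
  ∑<+b+1+b≤n*b {j} {j′} {j″} j<j′ j′<j″ j″<n fj≡0 fj′<b fj″≡0 =
    gap-≤ (≤-trans (+-mono-≤ (+-mono-≤ (≤-reflexive (cong (b ∸_) (sym fj≡0))) (m<n⇒0<n∸m fj′<b))
                             (≤-reflexive (cong (b ∸_) (sym fj″≡0))))
                   (∑<-≥-three-terms n (λ k → b ∸ f k) j<j′ j′<j″ j″<n))

∑<-ends-zero : ∀ m b {f} → (∀ k → k < suc (suc m) → f k ≤ b) → f 0 ≡ 0 → f (suc m) ≡ 0 → ∑< (suc (suc m)) f ≤ m * b
∑<-ends-zero m b {f} f≤b f0≡0 f1+m≡0 = +-cancelʳ-≤ (b + b) (∑< (suc (suc m)) f) (m * b)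
  (≤-trans (∑<+b+b≤n*b (suc (suc m)) b f≤b (s≤s z≤n) ≤-refl f0≡0 f1+m≡0)
           (≤-reflexive (trans (sym (+-assoc b b (m * b))) (+-comm (b + b) (m * b)))))

∑<-ends-zero-gap : ∀ m b {f} → (∀ k → k < suc (suc m) → f k ≤ b) → f 0 ≡ 0 → f (suc m) ≡ 0 →
                   ∀ {j} → 1 ≤ j → j ≤ m → f j < b → ∑< (suc (suc m)) f < m * b
∑<-ends-zero-gap m b {f} f≤b f0≡0 f1+m≡0 {j} 1≤j j≤m fj<b = +-cancelʳ-≤ (b + b) (suc Σf) (m * b) (begin
  suc (Σf + (b + b))    ≡⟨ +-suc Σf (b + b) ⟨
  Σf + suc (b + b)      ≡⟨ cong (λ x → Σf + (x + b)) (+-comm 1 b) ⟩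
  Σf + (b + 1 + b)      ≤⟨ ∑<+b+1+b≤n*b (suc (suc m)) b f≤b 1≤j (s≤s j≤m) ≤-refl f0≡0 fj<b f1+m≡0 ⟩
  suc (suc m) * b       ≡⟨ trans (sym (+-assoc b b (m * b))) (+-comm (b + b) (m * b)) ⟩
  m * b + (b + b)       ∎)
  where
  open ≤-Reasoning
  Σf = ∑< (suc (suc m)) f

module _ {A : Set} where

  indicator : {P : A → Set} → Decidable P → A → ℕ
  indicator P? x with P? x
  ... | yes _ = 1
  ... | no _  = 0

  count : {P : A → Set} → Decidable P → List A → ℕ
  count P? []      = 0
  count P? (x ∷ l) = indicator P? x + count P? l

  module _ {P : A → Set} (P? : Decidable P) where

    count-pos⇒∃ : ∀ l → 1 ≤ count P? l → Σ A λ x → x ∈ l × P x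
    count-pos⇒∃ (x ∷ l) pos with P? x
    ... | yes px = x , here refl , px
    ... | no _ with count-pos⇒∃ l pos
    ...   | y , y∈l , py = y , there y∈l , py

    count≡0 : ∀ l → (∀ x → x ∈ l → ¬ P x) → count P? l ≡ 0
    count≡0 []      none = refl
    count≡0 (x ∷ l) none with P? x
    ... | yes px = ⊥-elim (none x (here refl) px)
    ... | no _   = count≡0 l (λ y y∈l → none y (there y∈l))

    module _ {D : A → A → Set} where

      count≥2⇒two : ∀ l → AllPairs D l → 2 ≤ count P? l →
                    Σ A λ x → Σ A λ y → x ∈ l × y ∈ l × P x × P y × D x y
      count≥2⇒two (x ∷ l) (Dx ∷ Dl) two with P? x
      ... | yes px with count-pos⇒∃ l (≤-pred two)
      ...   | y , y∈l , py = x , y , here refl , there y∈l , px , py , All.lookup Dx y∈l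
      count≥2⇒two (x ∷ l) (Dx ∷ Dl) two | no _ with count≥2⇒two l Dl two
      ...   | y , z , y∈l , z∈l , py , pz , Dyz = y , z , there y∈l , there z∈l , py , pz , Dyz

      count≥3⇒three : ∀ l → AllPairs D l → 3 ≤ count P? l →
                      Σ A λ x → Σ A λ y → Σ A λ z → x ∈ l × y ∈ l × z ∈ l × P x × P y × P z × D x y × D y z × D x z
      count≥3⇒three (x ∷ l) (Dx ∷ Dl) three with P? x
      ... | yes px with count≥2⇒two l Dl (≤-pred three)
      ...   | y , z , y∈l , z∈l , py , pz , Dyz =
              x , y , z , here refl , there y∈l , there z∈l , px , py , pz , All.lookup Dx y∈l , Dyz , All.lookup Dx z∈l
      count≥3⇒three (x ∷ l) (Dx ∷ Dl) three | no _ with count≥3⇒three l Dl three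
      ...   | y , z , w , y∈l , z∈l , w∈l , py , pz , pw , Dyz , Dzw , Dyw =
              y , z , w , there y∈l , there z∈l , there w∈l , py , pz , pw , Dyz , Dzw , Dyw

  module _ {P : ℕ → A → Set} (P? : ∀ i → Decidable (P i)) where

    ∑indicator≡0 : ∀ n x → (∀ i → i < n → ¬ P i x) → ∑< n (λ i → indicator (P? i) x) ≡ 0
    ∑indicator≡0 zero    x none = refl
    ∑indicator≡0 (suc n) x none with P? n x
    ... | yes pn = ⊥-elim (none n ≤-refl pn)
    ... | no _   = trans (+-identityʳ _) (∑indicator≡0 n x (λ i i<n → none i (m<n⇒m<1+n i<n)))

    ∑indicator≡1 : ∀ n x {a} → a < n → P a x → (∀ i → P i x → i ≡ a) → ∑< n (λ i → indicator (P? i) x) ≡ 1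
    ∑indicator≡1 (suc n) x {a} a<1+n pa unique with P? n x
    ... | yes pn = cong (_+ 1) (∑indicator≡0 n x (λ i i<n pi → <⇒≢ i<n (trans (unique i pi) (sym (unique n pn)))))
    ... | no ¬pn with m≤n⇒m<n∨m≡n (≤-pred a<1+n)
    ...   | inj₁ a<n = trans (+-identityʳ _) (∑indicator≡1 n x a<n pa unique)
    ...   | inj₂ refl = ⊥-elim (¬pn pa)

  length≡∑count : ∀ m n {P Q : ℕ → A → Set} (P? : ∀ i → Decidable (P i)) (Q? : ∀ j → Decidable (Q j)) l →
    All (λ x → ∑< m (λ i → indicator (P? i) x) + ∑< n (λ j → indicator (Q? j) x) ≡ 1) l →
    length l ≡ ∑< m (λ i → count (P? i) l) + ∑< n (λ j → count (Q? j) l)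
  length≡∑count m n P? Q? [] [] = sym (cong₂ _+_ (trans (∑<-const m 0) (*-zeroʳ m)) (trans (∑<-const n 0) (*-zeroʳ n)))
  length≡∑count m n P? Q? (x ∷ l) (once ∷ onces) = begin
    1 + length l                 ≡⟨ cong₂ _+_ (sym once) (length≡∑count m n P? Q? l onces) ⟩
    (Ip + Iq) + (Cp + Cq)        ≡⟨ interchange Ip Iq Cp Cq ⟩
    (Ip + Cp) + (Iq + Cq)        ≡⟨ cong₂ _+_ (∑<-+ m (λ i → indicator (P? i) x) (λ i → count (P? i) l))
                                               (∑<-+ n (λ j → indicator (Q? j) x) (λ j → count (Q? j) l)) ⟨
    ∑< m (λ i → count (P? i) (x ∷ l)) + ∑< n (λ j → count (Q? j) (x ∷ l)) ∎
    where
    open ≡-Reasoning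
    Ip = ∑< m (λ i → indicator (P? i) x)
    Iq = ∑< n (λ j → indicator (Q? j) x)
    Cp = ∑< m (λ i → count (P? i) l)
    Cq = ∑< n (λ j → count (Q? j) l)

AllPairs-lookup : ∀ {A : Set} {R : A → A → Set} → (∀ {x y} → R x y → R y x) → ∀ {l} → AllPairs R l →
                  ∀ {i j} → i ≢ j → R (lookup l i) (lookup l j)
AllPairs-lookup sym {x ∷ l} (Rx ∷ Rl) {fz}   {fz}   i≢j = ⊥-elim (i≢j refl)
AllPairs-lookup sym {x ∷ l} (Rx ∷ Rl) {fz}   {fs j} i≢j = All.lookup Rx (∈-lookup j)
AllPairs-lookup sym {x ∷ l} (Rx ∷ Rl) {fs i} {fz}   i≢j = sym (All.lookup Rx (∈-lookup i))
AllPairs-lookup sym {x ∷ l} (Rx ∷ Rl) {fs i} {fs j} i≢j = AllPairs-lookup sym Rl (λ i≡j → i≢j (cong fs i≡j))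

module Walks (G : Graph) where

  private
    W = V G

  _≈_ : W × W → W × W → Set
  _≈_ = _≈ₑ_ G

  _on_ : W × W → List W → Set
  _on_ = _OnWalk_ G

  Distinct : W × W → W × W → Set
  Distinct e f = ¬ (e ≈ f)

  ≈-sym : ∀ {e f} → e ≈ f → f ≈ e
  ≈-sym (inj₁ (refl , refl)) = inj₁ (refl , refl)
  ≈-sym (inj₂ (refl , refl)) = inj₂ (refl , refl)

  ≈-trans : ∀ {e f g} → e ≈ f → f ≈ g → e ≈ g
  ≈-trans (inj₁ (refl , refl)) f≈g                  = f≈g
  ≈-trans (inj₂ (refl , refl)) (inj₁ (refl , refl)) = inj₂ (refl , refl)
  ≈-trans (inj₂ (refl , refl)) (inj₂ (refl , refl)) = inj₁ (refl , refl)

  Distinct-sym : ∀ {e f} → Distinct e f → Distinct f e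
  Distinct-sym e≉f f≈e = e≉f (≈-sym f≈e)

  on-resp-≈ : ∀ {e f p} → e ≈ f → f on p → e on p
  on-resp-≈ e≈f = Any.map (≈-trans e≈f)

  -- IsEdgeGP, phrased with membership instead of indices
  NoThreeOnGeodesic : List (W × W) → Set
  NoThreeOnGeodesic T = ∀ p → IsGeodesic G p → ∀ {e f g} → e ∈ T → f ∈ T → g ∈ T →
    Distinct e f → Distinct f g → Distinct e g → e on p → f on p → g on p → ⊥

  edgeGP⁻ : ∀ {T} → IsEdgeGP G T → NoThreeOnGeodesic T
  edgeGP⁻ {T} gp p geo e∈T f∈T g∈T e≉f f≉g e≉g e-on f-on g-on =
    gp p geo (index e∈T , index f∈T , index g∈T ,
              index-≢ e∈T f∈T e≉f , index-≢ f∈T g∈T f≉g , index-≢ e∈T g∈T e≉g ,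
              lookup-on e∈T e-on , lookup-on f∈T f-on , lookup-on g∈T g-on)
    where
    lookup-on : ∀ {e} (e∈T : e ∈ T) → e on p → lookup T (index e∈T) on p
    lookup-on e∈T = subst (_on p) (Anyₚ.lookup-index e∈T)
    index-≢ : ∀ {e f} (e∈T : e ∈ T) (f∈T : f ∈ T) → Distinct e f → index e∈T ≢ index f∈T
    index-≢ e∈T f∈T e≉f i≡j = e≉f (inj₁ (cong proj₁ e≡f , cong proj₂ e≡f))
      where
      e≡f = trans (Anyₚ.lookup-index e∈T) (trans (cong (lookup T) i≡j) (sym (Anyₚ.lookup-index f∈T)))

  edgeGP⁺ : ∀ {S} → AllPairs Distinct S → NoThreeOnGeodesic S → IsEdgeGP G S
  edgeGP⁺ {S} distinct none p geo (i , j , k , i≢j , j≢k , i≢k , i-on , j-on , k-on) =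
    none p geo (∈-lookup i) (∈-lookup j) (∈-lookup k)
      (AllPairs-lookup Distinct-sym distinct i≢j) (AllPairs-lookup Distinct-sym distinct j≢k)
      (AllPairs-lookup Distinct-sym distinct i≢k) i-on j-on k-on

  infix 4 _∈≈_
  _∈≈_ : W × W → List (W × W) → Set
  _∈≈_ = _∈ₑ_ G

  ∈≈-resp-≈ : ∀ {e f T} → e ≈ f → f ∈≈ T → e ∈≈ T
  ∈≈-resp-≈ e≈f = Any.map (≈-trans e≈f)

  Distinct-resp-≈ : ∀ {e e′ f f′} → e ≈ e′ → f ≈ f′ → Distinct e f → Distinct e′ f′
  Distinct-resp-≈ e≈e′ f≈f′ e≉f e′≈f′ = e≉f (≈-trans e≈e′ (≈-trans e′≈f′ (≈-sym f≈f′)))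

  no-three-∈≈ : ∀ {T} → NoThreeOnGeodesic T → ∀ p → IsGeodesic G p → ∀ {e f g} → e ∈≈ T → f ∈≈ T → g ∈≈ T →
                Distinct e f → Distinct f g → Distinct e g → e on p → f on p → g on p → ⊥
  no-three-∈≈ none p geo e∈ f∈ g∈ e≉f f≉g e≉g e-on f-on g-on with find e∈ | find f∈ | find g∈
  ... | _ , e′∈ , e≈e′ | _ , f′∈ , f≈f′ | _ , g′∈ , g≈g′ =
    none p geo e′∈ f′∈ g′∈
      (Distinct-resp-≈ e≈e′ f≈f′ e≉f) (Distinct-resp-≈ f≈f′ g≈g′ f≉g) (Distinct-resp-≈ e≈e′ g≈g′ e≉g)
      (on-resp-≈ (≈-sym e≈e′) e-on) (on-resp-≈ (≈-sym f≈f′) f-on) (on-resp-≈ (≈-sym g≈g′) g-on)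

  infixl 5 _⊕_
  _⊕_ : List W → List W → List W
  p ⊕ q = p ++ drop 1 q

  private
    last-++ : ∀ (p : List W) {z} q → last p ≡ just z → last (p ++ q) ≡ last (z ∷ q)
    last-++ (x ∷ [])    q refl = refl
    last-++ (x ∷ y ∷ p) q eq   = last-++ (y ∷ p) q eq

    steps-++ : ∀ (p : List W) {z} q → last p ≡ just z → steps G (p ++ q) ≡ steps G p ++ steps G (z ∷ q)
    steps-++ (x ∷ [])    q refl = refl
    steps-++ (x ∷ y ∷ p) q eq   = cong ((x , y) ∷_) (steps-++ (y ∷ p) q eq)

    steps-⊕ : ∀ {u w v p q} → IsWalk G u w p → IsWalk G w v q → steps G (p ⊕ q) ≡ steps G p ++ steps G q
    steps-⊕ {p = []}    (() , _)
    steps-⊕ {p = _ ∷ _} {[]} _ (() , _)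
    steps-⊕ {p = x ∷ p} {_ ∷ q} (_ , last-p , _) (refl , _) = steps-++ (x ∷ p) q last-p

  ⊕-walk : ∀ {u w v p q} → IsWalk G u w p → IsWalk G w v q → IsWalk G u v (p ⊕ q)
  ⊕-walk {p = []}    (() , _)
  ⊕-walk {p = _ ∷ _} {[]} _ (() , _)
  ⊕-walk {p = x ∷ p} {_ ∷ q} (head-p , last-p , p-adj) (refl , last-q , q-adj) =
    head-p , trans (last-++ (x ∷ p) q last-p) last-q ,
    subst (All _) (sym (steps-++ (x ∷ p) q last-p)) (Allₚ.++⁺ p-adj q-adj)

  ⊕-length : ∀ {u w v p q} → IsWalk G u w p → IsWalk G w v q → suc (length (p ⊕ q)) ≡ length p + length q
  ⊕-length {p = []}    (() , _)
  ⊕-length {p = _ ∷ _} {[]} _ (() , _)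
  ⊕-length {p = x ∷ p} {_ ∷ q} _ _ = trans (cong suc (length-++ (x ∷ p))) (sym (+-suc (length (x ∷ p)) (length q)))

  on-⊕ˡ : ∀ {u w v p q e} → IsWalk G u w p → IsWalk G w v q → e on p → e on (p ⊕ q)
  on-⊕ˡ p-walk q-walk e-on = subst (Any _) (sym (steps-⊕ p-walk q-walk)) (Anyₚ.++⁺ˡ e-on)

  on-⊕ʳ : ∀ {u w v p q e} → IsWalk G u w p → IsWalk G w v q → e on q → e on (p ⊕ q)
  on-⊕ʳ {p = p} p-walk q-walk e-on = subst (Any _) (sym (steps-⊕ p-walk q-walk)) (Anyₚ.++⁺ʳ (steps G p) e-on)

  IsEnd : W → W × W → Set
  IsEnd a e = a ≡ proj₁ e ⊎ a ≡ proj₂ e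

  -- e precedes f on p: every reflexive relation that holds between each vertex of p and all later ones
  -- relates each end of e to each end of f
  Precedes : List W → W × W → W × W → Set₁
  Precedes p e f = ∀ (R : W → W → Set) → (∀ z → R z z) → AllPairs R p →
                   ∀ a b → IsEnd a e → IsEnd b f → R a b

  IsEnd-resp-≈ : ∀ {a e f} → e ≈ f → IsEnd a e → IsEnd a f
  IsEnd-resp-≈ (inj₁ (refl , refl)) a-end        = a-end
  IsEnd-resp-≈ (inj₂ (refl , refl)) (inj₁ a≡e₁) = inj₂ a≡e₁
  IsEnd-resp-≈ (inj₂ (refl , refl)) (inj₂ a≡e₂) = inj₁ a≡e₂

  end∈walk : ∀ {a e} p → e on p → IsEnd a e → Any (a ≡_) p
  end∈walk (x ∷ y ∷ p) (here e≈xy) a-end with IsEnd-resp-≈ e≈xy a-end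
  ... | inj₁ a≡x = here a≡x
  ... | inj₂ a≡y = there (here a≡y)
  end∈walk (x ∷ y ∷ p) (there e-on) a-end = there (end∈walk (y ∷ p) e-on a-end)

  precedes-total : ∀ p {e f} → e on p → f on p → Distinct e f → Precedes p e f ⊎ Precedes p f e
  precedes-total (x ∷ y ∷ p) (here e≈xy) (here f≈xy) e≉f = ⊥-elim (e≉f (≈-trans e≈xy (≈-sym f≈xy)))
  precedes-total (x ∷ y ∷ p) {e} {f} (here e≈xy) (there f-on) e≉f = inj₁ first-precedes
    where
    first-precedes : Precedes (x ∷ y ∷ p) e f
    first-precedes R refl-R (Rx ∷ Ry ∷ _) a b a-end b-end with IsEnd-resp-≈ e≈xy a-end | end∈walk (y ∷ p) f-on b-end
    ... | inj₁ refl | b∈ = All.lookup Rx b∈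
    ... | inj₂ refl | here refl = refl-R a
    ... | inj₂ refl | there b∈ = All.lookup Ry b∈
  precedes-total (x ∷ y ∷ p) (there e-on) (here f≈xy) e≉f =
    Sum.swap (precedes-total (x ∷ y ∷ p) (here f≈xy) (there e-on) (Distinct-sym e≉f))
  precedes-total (x ∷ y ∷ p) (there e-on) (there f-on) e≉f with precedes-total (y ∷ p) e-on f-on e≉f
  ... | inj₁ e<f = inj₁ (λ R refl-R Rp → e<f R refl-R (AllPairs.tail Rp))
  ... | inj₂ f<e = inj₂ (λ R refl-R Rp → f<e R refl-R (AllPairs.tail Rp))

  AnyEnd : (W → Set) → W × W → Set
  AnyEnd Q e = Q (proj₁ e) ⊎ Q (proj₂ e)

  anyEnd⇒end : ∀ {Q e} → AnyEnd Q e → Σ W λ a → IsEnd a e × Q a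
  anyEnd⇒end {e = a , _} (inj₁ qa) = a , inj₁ refl , qa
  anyEnd⇒end {e = _ , b} (inj₂ qb) = b , inj₂ refl , qb

  Monotone : (W → ℕ) → List W → Set
  Monotone f p = AllPairs (λ a b → f a ≤ f b) p ⊎ AllPairs (λ a b → f b ≤ f a) p

  no-strict-extremum : ∀ f p {a m c} → Monotone f p → Precedes p a m → Precedes p m c →
                       ∀ {x y z} → IsEnd x a → IsEnd y m → IsEnd z c →
                       ¬ ((f y < f x × f y < f z) ⊎ (f x < f y × f z < f y))
  no-strict-extremum f p (inj₁ asc) a≺m m≺c {x} {y} {z} x-end y-end z-end extremum
    with a≺m (λ a b → f a ≤ f b) (λ _ → ≤-refl) asc x y x-end y-end | m≺c (λ a b → f a ≤ f b) (λ _ → ≤-refl) asc y z y-end z-end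
  ... | fx≤fy | fy≤fz = [ (λ (fy<fx , _) → <⇒≱ fy<fx fx≤fy) , (λ (_ , fz<fy) → <⇒≱ fz<fy fy≤fz) ]′ extremum
  no-strict-extremum f p (inj₂ desc) a≺m m≺c {x} {y} {z} x-end y-end z-end extremum
    with a≺m (λ a b → f b ≤ f a) (λ _ → ≤-refl) desc x y x-end y-end | m≺c (λ a b → f b ≤ f a) (λ _ → ≤-refl) desc y z y-end z-end
  ... | fy≤fx | fz≤fy = [ (λ (_ , fy<fz) → <⇒≱ fy<fz fz≤fy) , (λ (fx<fy , _) → <⇒≱ fx<fy fy≤fx) ]′ extremum

  no-extremal-middle : ∀ f p {a m c B} → Monotone f p → Precedes p a m → Precedes p m c → AnyEnd (λ z → f z ≡ B) m →
                       (AnyEnd (λ z → B < f z) a × AnyEnd (λ z → B < f z) c) ⊎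
                       (AnyEnd (λ z → f z < B) a × AnyEnd (λ z → f z < B) c) → ⊥
  no-extremal-middle f p {a} {m} {c} {B} mono a≺m m≺c m-at-B outer with anyEnd⇒end {λ z → f z ≡ B} m-at-B
  ... | y , y-end , refl = [ (λ (a-above , c-above) → extremum (λ y<x y<z → inj₁ (y<x , y<z)) a-above c-above) ,
                             (λ (a-below , c-below) → extremum (λ x<y z<y → inj₂ (x<y , z<y)) a-below c-below) ]′ outer
    where
    extremum : ∀ {Q} → (∀ {x z} → Q x → Q z → (f y < f x × f y < f z) ⊎ (f x < f y × f z < f y)) →
               AnyEnd Q a → AnyEnd Q c → ⊥
    extremum {Q} strict a-side c-side with anyEnd⇒end {Q} a-side | anyEnd⇒end {Q} c-side
    ... | x , x-end , qx | z , z-end , qz = no-strict-extremum f p mono a≺m m≺c x-end y-end z-end (strict qx qz)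

  -- of three distinct edges on a walk one lies between the other two
  no-three-on-walk : ∀ (Q : W × W → Set) p → (∀ {a m c} → Q a → Q m → Q c → Precedes p a m → Precedes p m c → ⊥) →
                     ∀ {e f g} → Q e → Q f → Q g → e on p → f on p → g on p →
                     Distinct e f → Distinct f g → Distinct e g → ⊥
  no-three-on-walk Q p no-middle qe qf qg e-on f-on g-on e≉f f≉g e≉g
    with precedes-total p e-on f-on e≉f | precedes-total p f-on g-on f≉g | precedes-total p e-on g-on e≉g
  ... | inj₁ e≺f | inj₁ f≺g | _        = no-middle qe qf qg e≺f f≺g
  ... | inj₂ f≺e | inj₂ g≺f | _        = no-middle qg qf qe g≺f f≺e
  ... | inj₁ e≺f | inj₂ g≺f | inj₁ e≺g = no-middle qe qg qf e≺g g≺f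
  ... | inj₁ e≺f | inj₂ g≺f | inj₂ g≺e = no-middle qg qe qf g≺e e≺f
  ... | inj₂ f≺e | inj₁ f≺g | inj₁ e≺g = no-middle qf qe qg f≺e e≺g
  ... | inj₂ f≺e | inj₁ f≺g | inj₂ g≺e = no-middle qf qg qe f≺g g≺e

clamp : (n : ℕ) → ℕ → Fin (suc n)
clamp zero    x       = fz
clamp (suc n) zero    = fz
clamp (suc n) (suc x) = fs (clamp n x)

toℕ-clamp : ∀ n {x} → x ≤ n → toℕ (clamp n x) ≡ x
toℕ-clamp zero    z≤n       = refl
toℕ-clamp (suc n) z≤n       = refl
toℕ-clamp (suc n) (s≤s x≤n) = cong suc (toℕ-clamp n x≤n)

clamp-toℕ : ∀ n (i : Fin (suc n)) → clamp n (toℕ i) ≡ i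
clamp-toℕ n i = toℕ-injective (toℕ-clamp n (≤-pred (toℕ<n i)))

adjP⇒∣-∣≡1 : ∀ {n} {a b : Fin n} → Adj (P n) a b → ∣ toℕ a - toℕ b ∣ ≡ 1
adjP⇒∣-∣≡1 {a = a} (inj₁ 1+a≡b) = subst (λ x → ∣ toℕ a - x ∣ ≡ 1) 1+a≡b (∣n-1+n∣≡1 (toℕ a))
adjP⇒∣-∣≡1 {b = b} (inj₂ 1+b≡a) = subst (λ x → ∣ x - toℕ b ∣ ≡ 1) 1+b≡a (∣1+n-n∣≡1 (toℕ b))

adjP⇒≢ : ∀ {n} {a b : Fin n} → Adj (P n) a b → toℕ a ≢ toℕ b
adjP⇒≢ (inj₁ 1+a≡b) a≡b = n≢1+n _ (trans a≡b (sym 1+a≡b))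
adjP⇒≢ (inj₂ 1+b≡a) a≡b = n≢1+n _ (trans (sym a≡b) (sym 1+b≡a))

module Grid (R S : ℕ) where

  G : Graph
  G = P (suc R) □ P (suc S)

  open Walks G public

  Vertex : Set
  Vertex = Fin (suc R) × Fin (suc S)

  Edge : Set
  Edge = Vertex × Vertex

  IsEdge : Edge → Set
  IsEdge e = Adj G (proj₁ e) (proj₂ e)

  row col : Vertex → ℕ
  row u = toℕ (proj₁ u)
  col u = toℕ (proj₂ u)

  row≤R : ∀ u → row u ≤ R
  row≤R u = ≤-pred (toℕ<n (proj₁ u))

  col≤S : ∀ u → col u ≤ S
  col≤S u = ≤-pred (toℕ<n (proj₂ u))

  -- junk value: coordinates beyond R or S are clamped
  pt : ℕ → ℕ → Vertex
  pt x y = clamp R x , clamp S y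

  row-pt : ∀ {x} y → x ≤ R → row (pt x y) ≡ x
  row-pt y x≤R = toℕ-clamp R x≤R

  col-pt : ∀ x {y} → y ≤ S → col (pt x y) ≡ y
  col-pt x y≤S = toℕ-clamp S y≤S

  pt-row-col : ∀ u → pt (row u) (col u) ≡ u
  pt-row-col (a , b) = cong₂ _,_ (clamp-toℕ R a) (clamp-toℕ S b)

  ≡pt : ∀ u {x y} → row u ≡ x → col u ≡ y → u ≡ pt x y
  ≡pt u refl refl = sym (pt-row-col u)

  hEdge : ℕ → ℕ → Edge
  hEdge i t = pt i t , pt i (suc t)

  vEdge : ℕ → ℕ → Edge
  vEdge j k = pt k j , pt (suc k) j

  adj-sym : ∀ {u v} → Adj G u v → Adj G v u
  adj-sym (inj₁ (a , refl)) = inj₁ (Sum.swap a , refl)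
  adj-sym (inj₂ (refl , b)) = inj₂ (refl , Sum.swap b)

  hEdge-adj : ∀ x {t} → suc t ≤ S → IsEdge (hEdge x t)
  hEdge-adj x {t} 1+t≤S = inj₂ (refl , inj₁ (trans (cong suc (toℕ-clamp S (<⇒≤ 1+t≤S))) (sym (toℕ-clamp S 1+t≤S))))

  vEdge-adj : ∀ y {t} → suc t ≤ R → IsEdge (vEdge y t)
  vEdge-adj y {t} 1+t≤R = inj₁ (inj₁ (trans (cong suc (toℕ-clamp R (<⇒≤ 1+t≤R))) (sym (toℕ-clamp R 1+t≤R))) , refl)

  dist : Vertex → Vertex → ℕ
  dist u v = ∣ row u - row v ∣ + ∣ col u - col v ∣

  dist-pt : ∀ {x₁ y₁ x₂ y₂} → x₁ ≤ R → x₂ ≤ R → y₁ ≤ S → y₂ ≤ S →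
            dist (pt x₁ y₁) (pt x₂ y₂) ≡ ∣ x₁ - x₂ ∣ + ∣ y₁ - y₂ ∣
  dist-pt {x₁} {y₁} {x₂} {y₂} x₁≤R x₂≤R y₁≤S y₂≤S
    rewrite row-pt y₁ x₁≤R | row-pt y₂ x₂≤R | col-pt x₁ y₁≤S | col-pt x₂ y₂≤S = refl

  dist-refl : ∀ u → dist u u ≡ 0
  dist-refl u rewrite ∣n-n∣≡0 (row u) | ∣n-n∣≡0 (col u) = refl

  dist-adj : ∀ {u v} → Adj G u v → dist u v ≡ 1
  dist-adj {a , b} (inj₁ (a~a′ , refl)) = cong₂ _+_ (adjP⇒∣-∣≡1 a~a′) (∣n-n∣≡0 (toℕ b))
  dist-adj {a , b} (inj₂ (refl , b~b′)) = cong₂ _+_ (∣n-n∣≡0 (toℕ a)) (adjP⇒∣-∣≡1 b~b′)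

  dist-triangle : ∀ u v w → dist u w ≤ dist u v + dist v w
  dist-triangle u v w = ≤-trans (+-mono-≤ (∣-∣-triangle (row u) (row v) (row w)) (∣-∣-triangle (col u) (col v) (col w)))
    (≤-reflexive (interchange ∣ row u - row v ∣ ∣ row v - row w ∣ ∣ col u - col v ∣ ∣ col v - col w ∣))

  dist-step : ∀ {u v} w → Adj G u v → dist u w ≤ suc (dist v w)
  dist-step {u} {v} w u~v = ≤-trans (dist-triangle u v w) (≤-reflexive (cong (_+ dist v w) (dist-adj u~v)))

  walk-length-≥ : ∀ {u v} p → IsWalk G u v p → suc (dist u v) ≤ length p
  walk-length-≥ (x ∷ [])    (refl , refl , _) rewrite dist-refl x = s≤s z≤n
  walk-length-≥ {v = v} (x ∷ y ∷ p) (refl , last-p , x~y ∷ adj) =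
    s≤s (≤-trans (dist-step v x~y) (walk-length-≥ (y ∷ p) (refl , last-p , adj)))

  Tight : Vertex → Vertex → List Vertex → Set
  Tight u v p = IsWalk G u v p × length p ≡ suc (dist u v)

  tight⇒geodesic : ∀ {u v p} → Tight u v p → IsGeodesic G p
  tight⇒geodesic {u} {v} (walk , len) = u , v , walk , λ q q-walk → ≤-trans (≤-reflexive len) (walk-length-≥ q q-walk)

  tight-tail : ∀ {x y v} p → Tight x v (x ∷ y ∷ p) → Adj G x y × dist x v ≡ suc (dist y v) × Tight y v (y ∷ p)
  tight-tail {x} {y} {v} p ((refl , last-p , x~y ∷ adj) , len) = x~y , trans (sym len′) tail-len , (tail-walk , tail-len)
    where
    tail-walk : IsWalk G y v (y ∷ p)
    tail-walk = refl , last-p , adj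
    len′ : length (y ∷ p) ≡ dist x v
    len′ = suc-injective len
    tail-len : length (y ∷ p) ≡ suc (dist y v)
    tail-len = ≤-antisym (≤-trans (≤-reflexive len′) (dist-step v x~y)) (walk-length-≥ (y ∷ p) tail-walk)

  module Segment (f : ℕ → Vertex) (M : ℕ) (adj : ∀ t → suc t ≤ M → Adj G (f t) (f (suc t))) where

    private
      upTail : ℕ → ℕ → List Vertex
      upTail a zero    = []
      upTail a (suc k) = f (suc a) ∷ upTail (suc a) k

      up : ℕ → ℕ → List Vertex
      up a k = f a ∷ upTail a k

      downTail : ℕ → ℕ → List Vertex
      downTail a zero    = []
      downTail a (suc k) = f (k + a) ∷ downTail a k

      down : ℕ → ℕ → List Vertex
      down a k = f (k + a) ∷ downTail a k

      up-walk : ∀ a k → k + a ≤ M → IsWalk G (f a) (f (k + a)) (up a k)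
      up-walk a zero    k+a≤M = refl , refl , []
      up-walk a (suc k) k+a≤M with up-walk (suc a) k (≤-trans (≤-reflexive (+-suc k a)) k+a≤M)
      ... | _ , last-up , adj-up =
        refl , trans last-up (cong (just ∘ f) (+-suc k a)) , adj a (≤-trans (s≤s (m≤n+m a k)) k+a≤M) ∷ adj-up

      up-length : ∀ a k → length (up a k) ≡ suc k
      up-length a zero    = refl
      up-length a (suc k) = cong suc (up-length (suc a) k)

      up-on : ∀ a k {t} → a ≤ t → suc t ≤ k + a → (f t , f (suc t)) on up a k
      up-on a zero    a≤t t<a = ⊥-elim (<⇒≱ t<a a≤t)
      up-on a (suc k) a≤t t<k+a with m≤n⇒m<n∨m≡n a≤t
      ... | inj₂ refl = here (inj₁ (refl , refl))
      ... | inj₁ a<t  = there (up-on (suc a) k a<t (≤-trans t<k+a (≤-reflexive (sym (+-suc k a)))))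

      down-walk : ∀ a k → k + a ≤ M → IsWalk G (f (k + a)) (f a) (down a k)
      down-walk a zero    k+a≤M = refl , refl , []
      down-walk a (suc k) k+a≤M with down-walk a k (<⇒≤ k+a≤M)
      ... | _ , last-down , adj-down = refl , last-down , adj-sym (adj (k + a) k+a≤M) ∷ adj-down

      down-length : ∀ a k → length (down a k) ≡ suc k
      down-length a zero    = refl
      down-length a (suc k) = cong suc (down-length a k)

      down-on : ∀ a k {t} → a ≤ t → suc t ≤ k + a → (f t , f (suc t)) on down a k
      down-on a zero    a≤t t<a = ⊥-elim (<⇒≱ t<a a≤t)
      down-on a (suc k) a≤t t<k+a with m≤n⇒m<n∨m≡n (≤-pred t<k+a)
      ... | inj₂ refl = here (inj₂ (refl , refl))
      ... | inj₁ t<k+a′ = there (down-on a k a≤t t<k+a′)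

    segment : ∀ x₁ x₂ → x₁ ≤ M → x₂ ≤ M → Σ (List Vertex) λ p → IsWalk G (f x₁) (f x₂) p ×
              length p ≡ suc ∣ x₁ - x₂ ∣ × (∀ t → StepBetween t x₁ x₂ → (f t , f (suc t)) on p)
    segment x₁ x₂ x₁≤M x₂≤M with ≤-total x₁ x₂
    ... | inj₁ x₁≤x₂ = up x₁ k ,
                       subst (λ z → IsWalk G (f x₁) (f z) (up x₁ k)) k+x₁≡x₂ (up-walk x₁ k (≤-trans (≤-reflexive k+x₁≡x₂) x₂≤M)) ,
                       trans (up-length x₁ k) (cong suc (sym (m≤n⇒∣m-n∣≡n∸m x₁≤x₂))) , on
      where
      k = x₂ ∸ x₁
      k+x₁≡x₂ : k + x₁ ≡ x₂
      k+x₁≡x₂ = m∸n+n≡m x₁≤x₂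
      on : ∀ t → StepBetween t x₁ x₂ → (f t , f (suc t)) on up x₁ k
      on t (inj₁ (x₁≤t , t<x₂)) = up-on x₁ k x₁≤t (≤-trans t<x₂ (≤-reflexive (sym k+x₁≡x₂)))
      on t (inj₂ (x₂≤t , t<x₁)) = ⊥-elim (<⇒≱ (≤-trans t<x₁ x₁≤x₂) x₂≤t)
    ... | inj₂ x₂≤x₁ = down x₂ k ,
                       subst (λ z → IsWalk G (f z) (f x₂) (down x₂ k)) k+x₂≡x₁ (down-walk x₂ k (≤-trans (≤-reflexive k+x₂≡x₁) x₁≤M)) ,
                       trans (down-length x₂ k) (cong suc (sym (m≤n⇒∣n-m∣≡n∸m x₂≤x₁))) , on
      where
      k = x₁ ∸ x₂
      k+x₂≡x₁ : k + x₂ ≡ x₁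
      k+x₂≡x₁ = m∸n+n≡m x₂≤x₁
      on : ∀ t → StepBetween t x₁ x₂ → (f t , f (suc t)) on down x₂ k
      on t (inj₂ (x₂≤t , t<x₁)) = down-on x₂ k x₂≤t (≤-trans t<x₁ (≤-reflexive (sym k+x₂≡x₁)))
      on t (inj₁ (x₁≤t , t<x₂)) = ⊥-elim (<⇒≱ (≤-trans t<x₂ x₂≤x₁) x₁≤t)

  module Column (y : ℕ) = Segment (λ x → pt x y) R (λ t → vEdge-adj y)
  module Row (x : ℕ) = Segment (λ y → pt x y) S (λ t → hEdge-adj x)

  tight-⊕₃ : ∀ {u w w′ v p q r A B C} → IsWalk G u w p → IsWalk G w w′ q → IsWalk G w′ v r →
             length p ≡ suc A → length q ≡ suc B → length r ≡ suc C → A + B + C ≡ dist u v →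
             Tight u v (p ⊕ q ⊕ r)
  tight-⊕₃ {u} {v = v} {p} {q} {r} {A} {B} {C} p-walk q-walk r-walk p-len q-len r-len A+B+C≡dist =
    ⊕-walk (⊕-walk p-walk q-walk) r-walk , suc-injective (begin
      suc (length (p ⊕ q ⊕ r))     ≡⟨ ⊕-length (⊕-walk p-walk q-walk) r-walk ⟩
      length (p ⊕ q) + length r    ≡⟨ cong₂ _+_ pq-len r-len ⟩
      suc (A + B) + suc C          ≡⟨ cong suc (+-suc (A + B) C) ⟩
      suc (suc (A + B + C))        ≡⟨ cong (suc ∘ suc) A+B+C≡dist ⟩
      suc (suc (dist u v))         ∎)
    where
    open ≡-Reasoning
    pq-len : length (p ⊕ q) ≡ suc (A + B)
    pq-len = suc-injective (trans (⊕-length p-walk q-walk) (trans (cong₂ _+_ p-len q-len) (cong suc (+-suc A B))))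

  vhv-geodesic : ∀ {x₁ m x₂ y₁ y₂} → x₁ ≤ R → m ≤ R → x₂ ≤ R → y₁ ≤ S → y₂ ≤ S → Between x₁ m x₂ →
    Σ (List Vertex) λ p → Tight (pt x₁ y₁) (pt x₂ y₂) p ×
      (∀ t → StepBetween t x₁ m → vEdge y₁ t on p) ×
      (∀ t → StepBetween t y₁ y₂ → hEdge m t on p) ×
      (∀ t → StepBetween t m x₂ → vEdge y₂ t on p)
  vhv-geodesic {x₁} {m} {x₂} {y₁} {y₂} x₁≤R m≤R x₂≤R y₁≤S y₂≤S x₁-m-x₂
    with Column.segment y₁ x₁ m x₁≤R m≤R | Row.segment m y₁ y₂ y₁≤S y₂≤S | Column.segment y₂ m x₂ m≤R x₂≤R
  ... | p , p-walk , p-len , p-on | q , q-walk , q-len , q-on | r , r-walk , r-len , r-on =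
    p ⊕ q ⊕ r , tight-⊕₃ p-walk q-walk r-walk p-len q-len r-len lengths ,
    (λ t s → on-⊕ˡ pq-walk r-walk (on-⊕ˡ p-walk q-walk (p-on t s))) ,
    (λ t s → on-⊕ˡ pq-walk r-walk (on-⊕ʳ p-walk q-walk (q-on t s))) ,
    (λ t s → on-⊕ʳ pq-walk r-walk (r-on t s))
    where
    pq-walk = ⊕-walk p-walk q-walk
    lengths : ∣ x₁ - m ∣ + ∣ y₁ - y₂ ∣ + ∣ m - x₂ ∣ ≡ dist (pt x₁ y₁) (pt x₂ y₂)
    lengths = trans (xy∙z≈xz∙y ∣ x₁ - m ∣ ∣ y₁ - y₂ ∣ ∣ m - x₂ ∣)
                    (trans (cong (_+ ∣ y₁ - y₂ ∣) (∣-∣-between x₁ m x₂ x₁-m-x₂)) (sym (dist-pt x₁≤R x₂≤R y₁≤S y₂≤S)))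

  hvh-geodesic : ∀ {y₁ m y₂ x₁ x₂} → y₁ ≤ S → m ≤ S → y₂ ≤ S → x₁ ≤ R → x₂ ≤ R → Between y₁ m y₂ →
    Σ (List Vertex) λ p → Tight (pt x₁ y₁) (pt x₂ y₂) p ×
      (∀ t → StepBetween t y₁ m → hEdge x₁ t on p) ×
      (∀ t → StepBetween t x₁ x₂ → vEdge m t on p) ×
      (∀ t → StepBetween t m y₂ → hEdge x₂ t on p)
  hvh-geodesic {y₁} {m} {y₂} {x₁} {x₂} y₁≤S m≤S y₂≤S x₁≤R x₂≤R y₁-m-y₂
    with Row.segment x₁ y₁ m y₁≤S m≤S | Column.segment m x₁ x₂ x₁≤R x₂≤R | Row.segment x₂ m y₂ m≤S y₂≤S
  ... | p , p-walk , p-len , p-on | q , q-walk , q-len , q-on | r , r-walk , r-len , r-on =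
    p ⊕ q ⊕ r , tight-⊕₃ p-walk q-walk r-walk p-len q-len r-len lengths ,
    (λ t s → on-⊕ˡ pq-walk r-walk (on-⊕ˡ p-walk q-walk (p-on t s))) ,
    (λ t s → on-⊕ˡ pq-walk r-walk (on-⊕ʳ p-walk q-walk (q-on t s))) ,
    (λ t s → on-⊕ʳ pq-walk r-walk (r-on t s))
    where
    pq-walk = ⊕-walk p-walk q-walk
    lengths : ∣ y₁ - m ∣ + ∣ x₁ - x₂ ∣ + ∣ m - y₂ ∣ ≡ dist (pt x₁ y₁) (pt x₂ y₂)
    lengths = trans (xy∙z≈yx∙z ∣ y₁ - m ∣ ∣ x₁ - x₂ ∣ ∣ m - y₂ ∣)
                    (trans (+-assoc ∣ x₁ - x₂ ∣ ∣ y₁ - m ∣ ∣ m - y₂ ∣)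
                           (trans (cong (∣ x₁ - x₂ ∣ +_) (∣-∣-between y₁ m y₂ y₁-m-y₂)) (sym (dist-pt x₁≤R x₂≤R y₁≤S y₂≤S))))

  tight-walk : ∀ u v → Σ (List Vertex) (Tight u v)
  tight-walk u v with vhv-geodesic {y₁ = col u} {col v} (row≤R u) (row≤R v) (row≤R v) (col≤S u) (col≤S v) (between-end (row u) (row v))
  ... | p , tight , _ = p , subst₂ (λ a b → Tight a b p) (pt-row-col u) (pt-row-col v) tight

  geodesic⇒tight : ∀ p → (geo : IsGeodesic G p) → Tight (proj₁ geo) (proj₁ (proj₂ geo)) p
  geodesic⇒tight p (u , v , p-walk , shortest) with tight-walk u v
  ... | q , q-walk , q-len = p-walk , ≤-antisym (≤-trans (shortest q q-walk) (≤-reflexive q-len)) (walk-length-≥ p p-walk)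

  ends-between : ∀ {x y} v → Adj G x y → dist x v ≡ suc (dist y v) →
                 Between (row x) (row y) (row v) × Between (col x) (col y) (col v)
  ends-between {a , b} v (inj₁ (a~a′ , refl)) closer =
    step-towards (toℕ a) _ (row v) a~a′ (+-cancelʳ-≡ ∣ toℕ b - col v ∣ _ _ closer) , between-refl (toℕ b) (col v)
  ends-between {a , b} v (inj₂ (refl , b~b′)) closer =
    between-refl (toℕ a) (row v) ,
    step-towards (toℕ b) _ (col v) b~b′ (+-cancelˡ-≡ ∣ toℕ a - row v ∣ _ _ (trans closer (sym (+-suc ∣ toℕ a - row v ∣ _))))

  StepsToward : Vertex → Vertex × Vertex → Set
  StepsToward v e = Between (row (proj₁ e)) (row (proj₂ e)) (row v) × Between (col (proj₁ e)) (col (proj₂ e)) (col v)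

  tight⇒steps-toward : ∀ {x v} p → Tight x v (x ∷ p) → All (StepsToward v) (steps G (x ∷ p))
  tight⇒steps-toward []      tight = []
  tight⇒steps-toward {v = v} (y ∷ p) tight with tight-tail p tight
  ... | x~y , closer , tight′ = ends-between v x~y closer ∷ tight⇒steps-toward p tight′

  private
    ascending : ∀ (f : Vertex → ℕ) {c} x p → f x ≤ c → All (λ e → Between (f (proj₁ e)) (f (proj₂ e)) c) (steps G (x ∷ p)) →
                AllPairs (λ a b → f a ≤ f b) (x ∷ p)
    ascending f x []      fx≤c _ = [] ∷ []
    ascending f x (y ∷ p) fx≤c (x-y-c ∷ steps) with between-from-below fx≤c x-y-c
    ... | fx≤fy , fy≤c with ascending f y p fy≤c steps
    ... | asc@(fy≤ ∷ _) = (fx≤fy ∷ All.map (≤-trans fx≤fy) fy≤) ∷ asc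

    descending : ∀ (f : Vertex → ℕ) {c} x p → c ≤ f x → All (λ e → Between (f (proj₁ e)) (f (proj₂ e)) c) (steps G (x ∷ p)) →
                 AllPairs (λ a b → f b ≤ f a) (x ∷ p)
    descending f x []      c≤fx _ = [] ∷ []
    descending f x (y ∷ p) c≤fx (x-y-c ∷ steps) with between-from-above c≤fx x-y-c
    ... | fy≤fx , c≤fy with descending f y p c≤fy steps
    ... | desc@(≤fy ∷ _) = (fy≤fx ∷ All.map (λ fz≤fy → ≤-trans fz≤fy fy≤fx) ≤fy) ∷ desc

    monotone : ∀ (f : Vertex → ℕ) {c} x p → All (λ e → Between (f (proj₁ e)) (f (proj₂ e)) c) (steps G (x ∷ p)) →
               Monotone f (x ∷ p)
    monotone f {c} x p steps with ≤-total (f x) c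
    ... | inj₁ fx≤c = inj₁ (ascending f x p fx≤c steps)
    ... | inj₂ c≤fx = inj₂ (descending f x p c≤fx steps)

  geodesic-monotone : ∀ p → IsGeodesic G p → Monotone row p × Monotone col p
  geodesic-monotone (x ∷ p) geo@(u , v , (refl , _) , _) =
    monotone row x p (All.map proj₁ toward) , monotone col x p (All.map proj₂ toward)
    where
    toward = tight⇒steps-toward p (geodesic⇒tight (x ∷ p) geo)

  rowSum colSum : Edge → ℕ
  rowSum e = row (proj₁ e) + row (proj₂ e)
  colSum e = col (proj₁ e) + col (proj₂ e)

  rowSum-≢⇒distinct : ∀ {e f} → rowSum e ≢ rowSum f → Distinct e f
  rowSum-≢⇒distinct ≢ (inj₁ (refl , refl)) = ≢ refl
  rowSum-≢⇒distinct {a , b} ≢ (inj₂ (refl , refl)) = ≢ (+-comm (row a) (row b))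

  colSum-≢⇒distinct : ∀ {e f} → colSum e ≢ colSum f → Distinct e f
  colSum-≢⇒distinct ≢ (inj₁ (refl , refl)) = ≢ refl
  colSum-≢⇒distinct {a , b} ≢ (inj₂ (refl , refl)) = ≢ (+-comm (col a) (col b))

  vEdge-sums : ∀ {j x} → j ≤ S → suc x ≤ R → rowSum (vEdge j x) ≡ x + suc x × colSum (vEdge j x) ≡ j + j
  vEdge-sums {j} {x} j≤S 1+x≤R = cong₂ _+_ (row-pt j (<⇒≤ 1+x≤R)) (row-pt j 1+x≤R) , cong₂ _+_ (col-pt x j≤S) (col-pt (suc x) j≤S)

  hEdge-sums : ∀ {i y} → i ≤ R → suc y ≤ S → rowSum (hEdge i y) ≡ i + i × colSum (hEdge i y) ≡ y + suc y
  hEdge-sums {i} {y} i≤R 1+y≤S = cong₂ _+_ (row-pt y i≤R) (row-pt (suc y) i≤R) , cong₂ _+_ (col-pt i (<⇒≤ 1+y≤S)) (col-pt i 1+y≤S)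

  pt-injectiveˡ : ∀ {x y x′ y′} → x ≤ R → x′ ≤ R → pt x y ≡ pt x′ y′ → x ≡ x′
  pt-injectiveˡ {x} {y} {x′} {y′} x≤R x′≤R eq = trans (sym (row-pt y x≤R)) (trans (cong row eq) (row-pt y′ x′≤R))

  pt-injectiveʳ : ∀ {x y x′ y′} → y ≤ S → y′ ≤ S → pt x y ≡ pt x′ y′ → y ≡ y′
  pt-injectiveʳ {x} {y} {x′} {y′} y≤S y′≤S eq = trans (sym (col-pt x y≤S)) (trans (cong col eq) (col-pt x′ y′≤S))

  hEdge≉vEdge : ∀ {i t j k} → suc t ≤ S → j ≤ S → Distinct (hEdge i t) (vEdge j k)
  hEdge≉vEdge 1+t≤S j≤S (inj₁ (e₁ , e₂)) =
    n≢1+n _ (trans (pt-injectiveʳ (<⇒≤ 1+t≤S) j≤S e₁) (sym (pt-injectiveʳ 1+t≤S j≤S e₂)))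
  hEdge≉vEdge 1+t≤S j≤S (inj₂ (e₁ , e₂)) =
    n≢1+n _ (trans (pt-injectiveʳ (<⇒≤ 1+t≤S) j≤S e₁) (sym (pt-injectiveʳ 1+t≤S j≤S e₂)))

  hEdge≈hEdge⇒row≡ : ∀ {i t i′ t′} → i ≤ R → i′ ≤ R → hEdge i t ≈ hEdge i′ t′ → i ≡ i′
  hEdge≈hEdge⇒row≡ i≤R i′≤R (inj₁ (e₁ , _)) = pt-injectiveˡ i≤R i′≤R e₁
  hEdge≈hEdge⇒row≡ i≤R i′≤R (inj₂ (e₁ , _)) = pt-injectiveˡ i≤R i′≤R e₁

  vEdge≈vEdge⇒col≡ : ∀ {j k j′ k′} → j ≤ S → j′ ≤ S → vEdge j k ≈ vEdge j′ k′ → j ≡ j′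
  vEdge≈vEdge⇒col≡ j≤S j′≤S (inj₁ (e₁ , _)) = pt-injectiveʳ j≤S j′≤S e₁
  vEdge≈vEdge⇒col≡ j≤S j′≤S (inj₂ (e₁ , _)) = pt-injectiveʳ j≤S j′≤S e₁

  hEdge≈hEdge⇒≡ : ∀ {i t t′} → suc t ≤ S → suc t′ ≤ S → hEdge i t ≈ hEdge i t′ → t ≡ t′
  hEdge≈hEdge⇒≡ 1+t≤S 1+t′≤S (inj₁ (e₁ , _)) = pt-injectiveʳ (<⇒≤ 1+t≤S) (<⇒≤ 1+t′≤S) e₁
  hEdge≈hEdge⇒≡ 1+t≤S 1+t′≤S (inj₂ (e₁ , e₂)) =
    ⊥-elim (n≢2+n _ (trans (pt-injectiveʳ (<⇒≤ 1+t≤S) 1+t′≤S e₁) (cong suc (pt-injectiveʳ (<⇒≤ 1+t′≤S) 1+t≤S (sym e₂)))))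

  vEdge≈vEdge⇒≡ : ∀ {j k k′} → suc k ≤ R → suc k′ ≤ R → vEdge j k ≈ vEdge j k′ → k ≡ k′
  vEdge≈vEdge⇒≡ 1+k≤R 1+k′≤R (inj₁ (e₁ , _)) = pt-injectiveˡ (<⇒≤ 1+k≤R) (<⇒≤ 1+k′≤R) e₁
  vEdge≈vEdge⇒≡ 1+k≤R 1+k′≤R (inj₂ (e₁ , e₂)) =
    ⊥-elim (n≢2+n _ (trans (pt-injectiveˡ (<⇒≤ 1+k≤R) 1+k′≤R e₁) (cong suc (pt-injectiveˡ (<⇒≤ 1+k′≤R) 1+k≤R (sym e₂)))))

  InRow InCol : ℕ → Edge → Set
  InRow i e = row (proj₁ e) ≡ i × row (proj₂ e) ≡ i
  InCol j e = col (proj₁ e) ≡ j × col (proj₂ e) ≡ j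

  InRow? : ∀ i → Decidable (InRow i)
  InRow? i e = (row (proj₁ e) ≟ i) ×-dec (row (proj₂ e) ≟ i)

  InCol? : ∀ j → Decidable (InCol j)
  InCol? j e = (col (proj₁ e) ≟ j) ×-dec (col (proj₂ e) ≟ j)

  inRow⇒hEdge : ∀ {i e} → IsEdge e → InRow i e → Σ ℕ λ t → suc t ≤ S × e ≈ hEdge i t
  inRow⇒hEdge {e = u , v} (inj₁ (u~v , _)) (refl , r) = ⊥-elim (adjP⇒≢ u~v (sym r))
  inRow⇒hEdge {e = u , v} (inj₂ (_ , inj₁ 1+u≡v)) (r₁ , r₂) =
    col u , subst (_≤ S) (sym 1+u≡v) (col≤S v) , inj₁ (≡pt u r₁ refl , ≡pt v r₂ (sym 1+u≡v))
  inRow⇒hEdge {e = u , v} (inj₂ (_ , inj₂ 1+v≡u)) (r₁ , r₂) =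
    col v , subst (_≤ S) (sym 1+v≡u) (col≤S u) , inj₂ (≡pt u r₁ (sym 1+v≡u) , ≡pt v r₂ refl)

  inCol⇒vEdge : ∀ {j e} → IsEdge e → InCol j e → Σ ℕ λ k → suc k ≤ R × e ≈ vEdge j k
  inCol⇒vEdge {e = u , v} (inj₂ (_ , u~v)) (refl , c) = ⊥-elim (adjP⇒≢ u~v (sym c))
  inCol⇒vEdge {e = u , v} (inj₁ (inj₁ 1+u≡v , _)) (c₁ , c₂) =
    row u , subst (_≤ R) (sym 1+u≡v) (row≤R v) , inj₁ (≡pt u refl c₁ , ≡pt v (sym 1+u≡v) c₂)
  inCol⇒vEdge {e = u , v} (inj₁ (inj₂ 1+v≡u , _)) (c₁ , c₂) =
    row v , subst (_≤ R) (sym 1+v≡u) (row≤R u) , inj₂ (≡pt u (sym 1+v≡u) c₁ , ≡pt v refl c₂)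

  InRow⇒≤R : ∀ {i} e → InRow i e → i ≤ R
  InRow⇒≤R (u , _) (refl , _) = row≤R u

  InCol⇒≤S : ∀ {j} e → InCol j e → j ≤ S
  InCol⇒≤S (u , _) (refl , _) = col≤S u

  -- every edge lies in exactly one row or in exactly one column
  length≡∑rows+∑cols : ∀ {T} → All IsEdge T →
    length T ≡ ∑< (suc R) (λ i → count (InRow? i) T) + ∑< (suc S) (λ j → count (InCol? j) T)
  length≡∑rows+∑cols {T} = length≡∑count (suc R) (suc S) InRow? InCol? T ∘ All.map once
    where
    once : ∀ {e} → IsEdge e → ∑< (suc R) (λ i → indicator (InRow? i) e) + ∑< (suc S) (λ j → indicator (InCol? j) e) ≡ 1
    once {u , v} (inj₁ (u~v , u≡v)) =
      cong₂ _+_ (∑indicator≡0 InRow? (suc R) (u , v) (λ i _ (r₁ , r₂) → adjP⇒≢ u~v (trans r₁ (sym r₂))))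
                (∑indicator≡1 InCol? (suc S) (u , v) (s≤s (col≤S u)) (refl , cong toℕ (sym u≡v)) (λ j (c₁ , _) → sym c₁))
    once {u , v} (inj₂ (u≡v , u~v)) =
      cong₂ _+_ (∑indicator≡1 InRow? (suc R) (u , v) (s≤s (row≤R u)) (refl , cong toℕ (sym u≡v)) (λ i (r₁ , _) → sym r₁))
                (∑indicator≡0 InCol? (suc S) (u , v) (λ j _ (c₁ , c₂) → adjP⇒≢ u~v (trans c₁ (sym c₂))))

  row-geodesic : ∀ {i} → i ≤ R → Σ (List Vertex) λ p → IsGeodesic G p × (∀ {t} → suc t ≤ S → hEdge i t on p)
  row-geodesic {i} i≤R with vhv-geodesic {y₁ = 0} {S} i≤R i≤R i≤R z≤n ≤-refl (between-refl i i)
  ... | p , tight , _ , in-row , _ = p , tight⇒geodesic tight , λ 1+t≤S → in-row _ (inj₁ (z≤n , 1+t≤S))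

  col-geodesic : ∀ {j} → j ≤ S → Σ (List Vertex) λ p → IsGeodesic G p × (∀ {k} → suc k ≤ R → vEdge j k on p)
  col-geodesic {j} j≤S with vhv-geodesic {x₁ = 0} {R} {R} {j} {j} z≤n ≤-refl ≤-refl j≤S j≤S (between-end 0 R)
  ... | p , tight , in-col , _ = p , tight⇒geodesic tight , λ 1+k≤R → in-col _ (inj₁ (z≤n , 1+k≤R))

-- The grid with inner rows 1, …, R and inner columns 1, …, S; a spoke joins an inner vertex to the frame.
module Spokes (R S : ℕ) where

  open Grid (suc R) (suc S) public

  data IsSpoke : Edge → Set where
    top    : ∀ {j} → 1 ≤ j → j ≤ S → IsSpoke (vEdge j 0)
    bottom : ∀ {j} → 1 ≤ j → j ≤ S → IsSpoke (vEdge j R)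
    left   : ∀ {i} → 1 ≤ i → i ≤ R → IsSpoke (hEdge i 0)
    right  : ∀ {i} → 1 ≤ i → i ≤ R → IsSpoke (hEdge i S)

  private
    side : (ℕ → Edge) → ℕ → List Edge
    side edge n = applyUpTo (edge ∘ suc) n

    ∈-side⁻ : ∀ edge {n e} → e ∈ side edge n → Σ ℕ λ k → 1 ≤ k × k ≤ n × e ≡ edge k
    ∈-side⁻ edge e∈ with ∈-applyUpTo⁻ (edge ∘ suc) e∈
    ... | k , k<n , refl = suc k , s≤s z≤n , k<n , refl

    ∈-side⁺ : ∀ edge {n k} → 1 ≤ k → k ≤ n → edge k ∈ side edge n
    ∈-side⁺ edge {k = suc k} _ k<n = ∈-applyUpTo⁺ (edge ∘ suc) k<n

    tops bottoms lefts rights : List Edge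
    tops    = side (λ j → vEdge j 0) S
    bottoms = side (λ j → vEdge j R) S
    lefts   = side (λ i → hEdge i 0) R
    rights  = side (λ i → hEdge i S) R

  spokes : List Edge
  spokes = tops ++ bottoms ++ lefts ++ rights

  length-spokes : length spokes ≡ (R + R) + (S + S)
  length-spokes = begin
    length spokes                                                      ≡⟨ length-++ tops ⟩
    length tops + length (bottoms ++ lefts ++ rights)                  ≡⟨ cong (length tops +_) (length-++ bottoms) ⟩
    length tops + (length bottoms + length (lefts ++ rights))          ≡⟨ cong (λ n → length tops + (length bottoms + n)) (length-++ lefts) ⟩
    length tops + (length bottoms + (length lefts + length rights))    ≡⟨ cong₂ _+_ (length-applyUpTo _ S)
                                                                           (cong₂ _+_ (length-applyUpTo _ S)
                                                                              (cong₂ _+_ (length-applyUpTo _ R) (length-applyUpTo _ R))) ⟩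
    S + (S + (R + R))                                                  ≡⟨ +-assoc S S (R + R) ⟨
    (S + S) + (R + R)                                                  ≡⟨ +-comm (S + S) (R + R) ⟩
    (R + R) + (S + S)                                                  ∎
    where open ≡-Reasoning

  ∈spokes⇒IsSpoke : ∀ {e} → e ∈ spokes → IsSpoke e
  ∈spokes⇒IsSpoke e∈ with ∈-++⁻ tops e∈
  ... | inj₁ e∈tops with ∈-side⁻ (λ j → vEdge j 0) e∈tops
  ...   | j , 1≤j , j≤S , refl = top 1≤j j≤S
  ∈spokes⇒IsSpoke e∈ | inj₂ e∈₁ with ∈-++⁻ bottoms e∈₁
  ... | inj₁ e∈bottoms with ∈-side⁻ (λ j → vEdge j R) e∈bottoms
  ...   | j , 1≤j , j≤S , refl = bottom 1≤j j≤S
  ∈spokes⇒IsSpoke e∈ | inj₂ e∈₁ | inj₂ e∈₂ with ∈-++⁻ lefts e∈₂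
  ... | inj₁ e∈lefts with ∈-side⁻ (λ i → hEdge i 0) e∈lefts
  ...   | i , 1≤i , i≤R , refl = left 1≤i i≤R
  ∈spokes⇒IsSpoke e∈ | inj₂ e∈₁ | inj₂ e∈₂ | inj₂ e∈rights with ∈-side⁻ (λ i → hEdge i S) e∈rights
  ...   | i , 1≤i , i≤R , refl = right 1≤i i≤R

  IsSpoke⇒∈spokes : ∀ {e} → IsSpoke e → e ∈ spokes
  IsSpoke⇒∈spokes (top 1≤j j≤S)    = ∈-++⁺ˡ (∈-side⁺ (λ j → vEdge j 0) 1≤j j≤S)
  IsSpoke⇒∈spokes (bottom 1≤j j≤S) = ∈-++⁺ʳ tops (∈-++⁺ˡ (∈-side⁺ (λ j → vEdge j R) 1≤j j≤S))
  IsSpoke⇒∈spokes (left 1≤i i≤R)   = ∈-++⁺ʳ tops (∈-++⁺ʳ bottoms (∈-++⁺ˡ (∈-side⁺ (λ i → hEdge i 0) 1≤i i≤R)))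
  IsSpoke⇒∈spokes (right 1≤i i≤R)  = ∈-++⁺ʳ tops (∈-++⁺ʳ bottoms (∈-++⁺ʳ lefts (∈-side⁺ (λ i → hEdge i S) 1≤i i≤R)))

  spoke-adj : ∀ {e} → IsSpoke e → IsEdge e
  spoke-adj (top {j} _ _)    = vEdge-adj j (s≤s z≤n)
  spoke-adj (bottom {j} _ _) = vEdge-adj j ≤-refl
  spoke-adj (left {i} _ _)   = hEdge-adj i (s≤s z≤n)
  spoke-adj (right {i} _ _)  = hEdge-adj i ≤-refl

  OffSides : Edge → Set
  OffSides e = AnyEnd (λ z → 0 < row z) e × AnyEnd (λ z → row z < suc R) e ×
               AnyEnd (λ z → 0 < col z) e × AnyEnd (λ z → col z < suc S) e

  OnSide : Edge → Set
  OnSide e = AnyEnd (λ z → row z ≡ 0) e ⊎ AnyEnd (λ z → row z ≡ suc R) e ⊎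
             AnyEnd (λ z → col z ≡ 0) e ⊎ AnyEnd (λ z → col z ≡ suc S) e

  module _ (1≤R : 1 ≤ R) (1≤S : 1 ≤ S) where

    private
      at : ∀ (Q : ℕ → ℕ → Set) {x y} → x ≤ suc R → y ≤ suc S → Q x y → Q (row (pt x y)) (col (pt x y))
      at Q {x} {y} x≤ y≤ = subst₂ Q (sym (row-pt y x≤)) (sym (col-pt x y≤))

    spoke-shape : ∀ {e} → IsSpoke e → OffSides e × OnSide e
    spoke-shape (top {j} 1≤j j≤S) =
      (inj₂ (at (λ x _ → 0 < x) (s≤s z≤n) j≤1+S (s≤s z≤n)) , inj₁ (at (λ x _ → x < suc R) z≤n j≤1+S (s≤s z≤n)) ,
       inj₁ (at (λ _ y → 0 < y) z≤n j≤1+S 1≤j) , inj₁ (at (λ _ y → y < suc S) z≤n j≤1+S (s≤s j≤S))) ,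
      inj₁ (inj₁ (row-pt j z≤n))
      where j≤1+S = m≤n⇒m≤1+n j≤S
    spoke-shape (bottom {j} 1≤j j≤S) =
      (inj₁ (at (λ x _ → 0 < x) (n≤1+n R) j≤1+S 1≤R) , inj₁ (at (λ x _ → x < suc R) (n≤1+n R) j≤1+S ≤-refl) ,
       inj₁ (at (λ _ y → 0 < y) (n≤1+n R) j≤1+S 1≤j) , inj₁ (at (λ _ y → y < suc S) (n≤1+n R) j≤1+S (s≤s j≤S))) ,
      inj₂ (inj₁ (inj₂ (row-pt j ≤-refl)))
      where j≤1+S = m≤n⇒m≤1+n j≤S
    spoke-shape (left {i} 1≤i i≤R) =
      (inj₁ (at (λ x _ → 0 < x) i≤1+R z≤n 1≤i) , inj₁ (at (λ x _ → x < suc R) i≤1+R z≤n (s≤s i≤R)) ,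
       inj₂ (at (λ _ y → 0 < y) i≤1+R (s≤s z≤n) (s≤s z≤n)) , inj₁ (at (λ _ y → y < suc S) i≤1+R z≤n (s≤s z≤n))) ,
      inj₂ (inj₂ (inj₁ (inj₁ (col-pt i z≤n))))
      where i≤1+R = m≤n⇒m≤1+n i≤R
    spoke-shape (right {i} 1≤i i≤R) =
      (inj₁ (at (λ x _ → 0 < x) i≤1+R (n≤1+n S) 1≤i) , inj₁ (at (λ x _ → x < suc R) i≤1+R (n≤1+n S) (s≤s i≤R)) ,
       inj₁ (at (λ _ y → 0 < y) i≤1+R (n≤1+n S) 1≤S) , inj₁ (at (λ _ y → y < suc S) i≤1+R (n≤1+n S) ≤-refl)) ,
      inj₂ (inj₂ (inj₂ (inj₂ (col-pt i ≤-refl))))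
      where i≤1+R = m≤n⇒m≤1+n i≤R

    -- the end of the middle spoke on a side would be a strict extremum of a monotone coordinate
    spokes-no-middle : ∀ p → Monotone row p → Monotone col p → ∀ {a m c} →
                       OffSides a × OnSide a → OffSides m × OnSide m → OffSides c × OnSide c →
                       Precedes p a m → Precedes p m c → ⊥
    spokes-no-middle p mono-row mono-col ((r>0 , r<max , c>0 , c<max) , _) (_ , m-on) ((r>0′ , r<max′ , c>0′ , c<max′) , _) a≺m m≺c
      with m-on
    ... | inj₁ at-0                = no-extremal-middle row p mono-row a≺m m≺c at-0 (inj₁ (r>0 , r>0′))
    ... | inj₂ (inj₁ at-max)        = no-extremal-middle row p mono-row a≺m m≺c at-max (inj₂ (r<max , r<max′))
    ... | inj₂ (inj₂ (inj₁ at-0))   = no-extremal-middle col p mono-col a≺m m≺c at-0 (inj₁ (c>0 , c>0′))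
    ... | inj₂ (inj₂ (inj₂ at-max)) = no-extremal-middle col p mono-col a≺m m≺c at-max (inj₂ (c<max , c<max′))

    spokes-no-three : NoThreeOnGeodesic spokes
    spokes-no-three p geo e∈ f∈ g∈ e≉f f≉g e≉g e-on f-on g-on with geodesic-monotone p geo
    ... | mono-row , mono-col =
      no-three-on-walk (λ e → OffSides e × OnSide e) p (spokes-no-middle p mono-row mono-col)
        (shape e∈) (shape f∈) (shape g∈) e-on f-on g-on e≉f f≉g e≉g
      where
      shape : ∀ {e} → e ∈ spokes → OffSides e × OnSide e
      shape = spoke-shape ∘ ∈spokes⇒IsSpoke

    private
      side-all : ∀ edge {n} (Q : Edge → Set) → (∀ {k} → 1 ≤ k → k ≤ n → Q (edge k)) → ∀ {e} → e ∈ side edge n → Q e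
      side-all edge Q Q-edge e∈ with ∈-side⁻ edge e∈
      ... | k , 1≤k , k≤n , refl = Q-edge 1≤k k≤n

      -- spokes on one side differ in the coordinate sum along that side
      side-distinct : ∀ edge n (sum : Edge → ℕ) → (∀ {e f} → sum e ≢ sum f → Distinct e f) →
                      (∀ {k} → 1 ≤ k → k ≤ n → sum (edge k) ≡ k + k) → AllPairs Distinct (side edge n)
      side-distinct edge n sum distinct sum≡ = AllPairsₚ.applyUpTo⁺₁ (edge ∘ suc) n λ {i} {j} i<j j<n →
        distinct λ eq → <⇒≢ i<j (suc-injective (m+m≡n+n⇒m≡n (suc i) (suc j)
          (trans (sym (sum≡ (s≤s z≤n) (<-trans i<j j<n))) (trans eq (sum≡ (s≤s z≤n) j<n)))))

      apart : ∀ {xs ys} (sum : Edge → ℕ) → (∀ {e f} → sum e ≢ sum f → Distinct e f) → ∀ {X Y : ℕ → Set} →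
              (∀ {a b} → X a → Y b → a ≢ b) → (∀ {e} → e ∈ xs → X (sum e)) → (∀ {f} → f ∈ ys → Y (sum f)) →
              All (λ e → All (Distinct e) ys) xs
      apart sum distinct X≢Y xs-sum ys-sum = All.tabulate λ e∈ → All.tabulate λ f∈ → distinct (X≢Y (xs-sum e∈) (ys-sum f∈))

      Even Odd : ℕ → Set
      Even n = Σ ℕ λ k → n ≡ k + k
      Odd n = Σ ℕ λ k → n ≡ suc (k + k)

      even≢odd′ : ∀ {a b} → Even a → Odd b → a ≢ b
      even≢odd′ (k , refl) (l , refl) = m+m≢1+n+n k l

      1≢1+n+n : ∀ {n} → 1 ≤ n → 1 ≢ suc (n + n)
      1≢1+n+n {suc n} _ ()

      tops-sums : ∀ {e} → e ∈ tops → rowSum e ≡ 1 × Even (colSum e)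
      tops-sums = side-all (λ j → vEdge j 0) (λ e → rowSum e ≡ 1 × Even (colSum e)) λ {j} _ j≤S →
        let (r , c) = vEdge-sums (m≤n⇒m≤1+n j≤S) (s≤s z≤n) in r , (j , c)

      bottoms-sums : ∀ {e} → e ∈ bottoms → rowSum e ≡ suc (R + R) × Even (colSum e)
      bottoms-sums = side-all (λ j → vEdge j R) (λ e → rowSum e ≡ suc (R + R) × Even (colSum e)) λ {j} _ j≤S →
        let (r , c) = vEdge-sums (m≤n⇒m≤1+n j≤S) ≤-refl in trans r (+-suc R R) , (j , c)

      lefts-sum : ∀ {e} → e ∈ lefts → colSum e ≡ 1
      lefts-sum = side-all (λ i → hEdge i 0) (λ e → colSum e ≡ 1) λ _ i≤R → proj₂ (hEdge-sums (m≤n⇒m≤1+n i≤R) (s≤s z≤n))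

      rights-sum : ∀ {e} → e ∈ rights → colSum e ≡ suc (S + S)
      rights-sum = side-all (λ i → hEdge i S) (λ e → colSum e ≡ suc (S + S)) λ _ i≤R →
        trans (proj₂ (hEdge-sums (m≤n⇒m≤1+n i≤R) ≤-refl)) (+-suc S S)

      sides-odd : ∀ {e} → e ∈ lefts ++ rights → Odd (colSum e)
      sides-odd e∈ = [ (λ e∈lefts → 0 , lefts-sum e∈lefts) , (λ e∈rights → S , rights-sum e∈rights) ]′ (∈-++⁻ lefts e∈)

      ++-across : ∀ {xs ys zs} → All (λ e → All (Distinct e) ys) xs → All (λ e → All (Distinct e) zs) xs →
                  All (λ e → All (Distinct e) (ys ++ zs)) xs
      ++-across ys-apart zs-apart = All.zipWith (λ (y , z) → Allₚ.++⁺ y z) (ys-apart , zs-apart)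

    spokes-distinct : AllPairs Distinct spokes
    spokes-distinct =
      AllPairsₚ.++⁺ tops-distinct
        (AllPairsₚ.++⁺ bottoms-distinct (AllPairsₚ.++⁺ lefts-distinct rights-distinct lefts-apart-rights) bottoms-apart-sides)
        (++-across tops-apart-bottoms tops-apart-sides)
      where
      tops-distinct = side-distinct (λ j → vEdge j 0) S colSum colSum-≢⇒distinct
        λ _ j≤S → proj₂ (vEdge-sums (m≤n⇒m≤1+n j≤S) (s≤s z≤n))
      bottoms-distinct = side-distinct (λ j → vEdge j R) S colSum colSum-≢⇒distinct
        λ _ j≤S → proj₂ (vEdge-sums (m≤n⇒m≤1+n j≤S) ≤-refl)
      lefts-distinct = side-distinct (λ i → hEdge i 0) R rowSum rowSum-≢⇒distinct
        λ _ i≤R → proj₁ (hEdge-sums (m≤n⇒m≤1+n i≤R) (s≤s z≤n))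
      rights-distinct = side-distinct (λ i → hEdge i S) R rowSum rowSum-≢⇒distinct
        λ _ i≤R → proj₁ (hEdge-sums (m≤n⇒m≤1+n i≤R) ≤-refl)
      lefts-apart-rights = apart colSum colSum-≢⇒distinct {_≡ 1} {_≡ suc (S + S)}
        (λ { refl refl → 1≢1+n+n 1≤S }) lefts-sum rights-sum
      bottoms-apart-sides = apart colSum colSum-≢⇒distinct even≢odd′ (proj₂ ∘ bottoms-sums) sides-odd
      tops-apart-bottoms = apart rowSum rowSum-≢⇒distinct {_≡ 1} {_≡ suc (R + R)}
        (λ { refl refl → 1≢1+n+n 1≤R }) (proj₁ ∘ tops-sums) (proj₁ ∘ bottoms-sums)
      tops-apart-sides = apart colSum colSum-≢⇒distinct even≢odd′ (proj₂ ∘ tops-sums) sides-odd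

    spokes-edgeSet : IsEdgeSet G spokes
    spokes-edgeSet = All.tabulate (spoke-adj ∘ ∈spokes⇒IsSpoke) , spokes-distinct

    spokes-edgeGP : IsEdgeGP G spokes
    spokes-edgeGP = edgeGP⁺ spokes-distinct spokes-no-three

  module Bound {T : List Edge} (T-set : IsEdgeSet G T) (T-gp : IsEdgeGP G T) where

    private
      T-edge : ∀ {e} → e ∈ T → IsEdge e
      T-edge = All.lookup (proj₁ T-set)

      no-three : NoThreeOnGeodesic T
      no-three = edgeGP⁻ T-gp

    rowCount colCount : ℕ → ℕ
    rowCount i = count (InRow? i) T
    colCount j = count (InCol? j) T

    rowCount≤2 : ∀ i → rowCount i ≤ 2
    rowCount≤2 i with 3 ≤? rowCount i
    ... | no ≱3 = ≤-pred (≰⇒> ≱3)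
    ... | yes ≥3 with count≥3⇒three (InRow? i) T (proj₂ T-set) ≥3
    ...   | e , f , g , e∈ , f∈ , g∈ , e-row , f-row , g-row , e≉f , f≉g , e≉g with row-geodesic (InRow⇒≤R e e-row)
    ...     | p , geo , row-on = ⊥-elim (no-three p geo e∈ f∈ g∈ e≉f f≉g e≉g (on e∈ e-row) (on f∈ f-row) (on g∈ g-row))
      where
      on : ∀ {e} → e ∈ T → InRow i e → e on p
      on e∈ e-row = let (_ , t<S , e≈) = inRow⇒hEdge (T-edge e∈) e-row in on-resp-≈ e≈ (row-on t<S)

    colCount≤2 : ∀ j → colCount j ≤ 2
    colCount≤2 j with 3 ≤? colCount j
    ... | no ≱3 = ≤-pred (≰⇒> ≱3)
    ... | yes ≥3 with count≥3⇒three (InCol? j) T (proj₂ T-set) ≥3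
    ...   | e , f , g , e∈ , f∈ , g∈ , e-col , f-col , g-col , e≉f , f≉g , e≉g with col-geodesic (InCol⇒≤S e e-col)
    ...     | p , geo , col-on = ⊥-elim (no-three p geo e∈ f∈ g∈ e≉f f≉g e≉g (on e∈ e-col) (on f∈ f-col) (on g∈ g-col))
      where
      on : ∀ {e} → e ∈ T → InCol j e → e on p
      on e∈ e-col = let (_ , k<R , e≈) = inCol⇒vEdge (T-edge e∈) e-col in on-resp-≈ e≈ (col-on k<R)

    rowCount≡0 : ∀ {i} → (∀ {t} → suc t ≤ suc S → ¬ (hEdge i t ∈≈ T)) → rowCount i ≡ 0
    rowCount≡0 {i} none = count≡0 (InRow? i) T λ e e∈ e-row →
      let (_ , t<S , e≈) = inRow⇒hEdge (T-edge e∈) e-row in none t<S (lose e∈ (≈-sym e≈))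

    colCount≡0 : ∀ {j} → (∀ {k} → suc k ≤ suc R → ¬ (vEdge j k ∈≈ T)) → colCount j ≡ 0
    colCount≡0 {j} none = count≡0 (InCol? j) T λ e e∈ e-col →
      let (_ , k<R , e≈) = inCol⇒vEdge (T-edge e∈) e-col in none k<R (lose e∈ (≈-sym e≈))

    record TwoInRow (i : ℕ) : Set where
      field
        a b : ℕ
        a<b : a < b
        b<S : b < suc S
        i≤R : i ≤ suc R
        a∈T : hEdge i a ∈≈ T
        b∈T : hEdge i b ∈≈ T

      a<S : a < suc S
      a<S = <-trans a<b b<S

      a≉b : Distinct (hEdge i a) (hEdge i b)
      a≉b a≈b = <⇒≢ a<b (hEdge≈hEdge⇒≡ a<S b<S a≈b)

    record TwoInCol (j : ℕ) : Set where
      field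
        a b : ℕ
        a<b : a < b
        b<R : b < suc R
        j≤S : j ≤ suc S
        a∈T : vEdge j a ∈≈ T
        b∈T : vEdge j b ∈≈ T

      a<R : a < suc R
      a<R = <-trans a<b b<R

      a≉b : Distinct (vEdge j a) (vEdge j b)
      a≉b a≈b = <⇒≢ a<b (vEdge≈vEdge⇒≡ a<R b<R a≈b)

    twoInRow : ∀ {i} → 2 ≤ rowCount i → TwoInRow i
    twoInRow {i} ≥2 with count≥2⇒two (InRow? i) T (proj₂ T-set) ≥2
    ... | e , f , e∈ , f∈ , e-row , f-row , e≉f with inRow⇒hEdge (T-edge e∈) e-row | inRow⇒hEdge (T-edge f∈) f-row
    ...   | t , t<S , e≈ | t′ , t′<S , f≈ with <-cmp t t′
    ...     | tri< t<t′ _ _ = record { a = t ; b = t′ ; a<b = t<t′ ; b<S = t′<S ; i≤R = InRow⇒≤R e e-row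
                                     ; a∈T = lose e∈ (≈-sym e≈) ; b∈T = lose f∈ (≈-sym f≈) }
    ...     | tri≈ _ refl _ = ⊥-elim (e≉f (≈-trans e≈ (≈-sym f≈)))
    ...     | tri> _ _ t′<t = record { a = t′ ; b = t ; a<b = t′<t ; b<S = t<S ; i≤R = InRow⇒≤R e e-row
                                     ; a∈T = lose f∈ (≈-sym f≈) ; b∈T = lose e∈ (≈-sym e≈) }

    twoInCol : ∀ {j} → 2 ≤ colCount j → TwoInCol j
    twoInCol {j} ≥2 with count≥2⇒two (InCol? j) T (proj₂ T-set) ≥2
    ... | e , f , e∈ , f∈ , e-col , f-col , e≉f with inCol⇒vEdge (T-edge e∈) e-col | inCol⇒vEdge (T-edge f∈) f-col
    ...   | k , k<R , e≈ | k′ , k′<R , f≈ with <-cmp k k′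
    ...     | tri< k<k′ _ _ = record { a = k ; b = k′ ; a<b = k<k′ ; b<R = k′<R ; j≤S = InCol⇒≤S e e-col
                                     ; a∈T = lose e∈ (≈-sym e≈) ; b∈T = lose f∈ (≈-sym f≈) }
    ...     | tri≈ _ refl _ = ⊥-elim (e≉f (≈-trans e≈ (≈-sym f≈)))
    ...     | tri> _ _ k′<k = record { a = k′ ; b = k ; a<b = k′<k ; b<R = k<R ; j≤S = InCol⇒≤S e e-col
                                     ; a∈T = lose f∈ (≈-sym f≈) ; b∈T = lose e∈ (≈-sym e≈) }

    module _ {i} (two : TwoInRow i) where
      open TwoInRow two

      -- otherwise a geodesic running along column c into row i would pass both edges of the pair
      no-vertical-outside : ∀ {c k} → c ≤ suc S → suc k ≤ suc R → c ≤ a ⊎ b < c → ¬ (vEdge c k ∈≈ T)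
      no-vertical-outside {c} {k} c≤S k<R outside k∈T with far-end k i | beyond-both a<b outside
      ... | x , x≤1+k , k-step , _ | y , y≤1+b , a-step , b-step
        with vhv-geodesic {y₁ = c} (≤-trans x≤1+k k<R) i≤R i≤R c≤S (≤-trans y≤1+b b<S) (between-end x i)
      ...   | p , tight , down , along , _ =
        no-three-∈≈ no-three p (tight⇒geodesic tight) a∈T b∈T k∈T a≉b (hEdge≉vEdge b<S c≤S) (hEdge≉vEdge a<S c≤S)
          (along a a-step) (along b b-step) (down k (Sum.swap k-step))

      row-edge≡a⊎b : ∀ {t} → suc t ≤ suc S → hEdge i t ∈≈ T → t ≡ a ⊎ t ≡ b
      row-edge≡a⊎b {t} t<S t∈T with t ≟ a | t ≟ b
      ... | yes t≡a | _       = inj₁ t≡a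
      ... | no _    | yes t≡b = inj₂ t≡b
      ... | no t≢a  | no t≢b with row-geodesic i≤R
      ...   | p , geo , on = ⊥-elim (no-three-∈≈ no-three p geo t∈T a∈T b∈T
                               (t≢a ∘ hEdge≈hEdge⇒≡ t<S a<S) a≉b (t≢b ∘ hEdge≈hEdge⇒≡ t<S b<S) (on t<S) (on a<S) (on b<S))

      -- the row across the vertical edge from row i is empty: a T-edge there would share a geodesic with
      -- the vertical edge and one edge of the pair
      empty-row-beside : ∀ {c k} → a < c → c ≤ b → suc k ≤ suc R → vEdge c k ∈≈ T → Σ ℕ λ r → r ≤ suc R × rowCount r ≡ 0
      empty-row-beside {c} {k} a<c c≤b k<R k∈T with far-end k i
      ... | r , r≤1+k , k-step , i≢r = r , r≤R , rowCount≡0 none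
        where
        r≤R = ≤-trans r≤1+k k<R
        c≤S = ≤-trans c≤b (<⇒≤ b<S)
        i≉r : ∀ {t t′} → Distinct (hEdge i t) (hEdge r t′)
        i≉r = i≢r ∘ hEdge≈hEdge⇒row≡ i≤R r≤R
        none : ∀ {t} → suc t ≤ suc S → ¬ (hEdge r t ∈≈ T)
        none {t} t<S t∈T with <-≤-connex t c
        ... | inj₂ c≤t with hvh-geodesic {x₁ = i} {x₂ = r} (<⇒≤ a<S) c≤S t<S i≤R r≤R (inj₁ (<⇒≤ a<c , ≤-trans c≤t (n≤1+n t)))
        ...   | p , tight , along , down , along′ =
          no-three-∈≈ no-three p (tight⇒geodesic tight) a∈T k∈T t∈T (hEdge≉vEdge a<S c≤S) (Distinct-sym (hEdge≉vEdge t<S c≤S)) i≉r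
            (along a (inj₁ (≤-refl , a<c))) (down k k-step) (along′ t (inj₁ (c≤t , ≤-refl)))
        none {t} t<S t∈T | inj₁ t<c
          with hvh-geodesic {x₁ = i} {x₂ = r} b<S c≤S (<⇒≤ t<S) i≤R r≤R (inj₂ (<⇒≤ t<c , ≤-trans c≤b (n≤1+n b)))
        ...   | p , tight , along , down , along′ =
          no-three-∈≈ no-three p (tight⇒geodesic tight) b∈T k∈T t∈T (hEdge≉vEdge b<S c≤S) (Distinct-sym (hEdge≉vEdge t<S c≤S)) i≉r
            (along b (inj₂ (c≤b , ≤-refl))) (down k k-step) (along′ t (inj₂ (≤-refl , t<c)))

      empty-row : ∀ {c} → 1 ≤ colCount c → Σ ℕ λ r → r ≤ suc R × rowCount r ≡ 0
      empty-row {c} pos with count-pos⇒∃ (InCol? c) T pos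
      ... | e , e∈ , e-col with inCol⇒vEdge (T-edge e∈) e-col | outside⊎inside c a b
      ...   | k , k<R , e≈ | inj₁ outside = ⊥-elim (no-vertical-outside (InCol⇒≤S e e-col) k<R outside (lose e∈ (≈-sym e≈)))
      ...   | k , k<R , e≈ | inj₂ (a<c , c≤b) = empty-row-beside a<c c≤b k<R (lose e∈ (≈-sym e≈))

    module _ {j} (two : TwoInCol j) where
      open TwoInCol two

      no-horizontal-outside : ∀ {r t} → r ≤ suc R → suc t ≤ suc S → r ≤ a ⊎ b < r → ¬ (hEdge r t ∈≈ T)
      no-horizontal-outside {r} {t} r≤R t<S outside t∈T with far-end t j | beyond-both a<b outside
      ... | x , x≤1+t , t-step , _ | y , y≤1+b , a-step , b-step
        with hvh-geodesic {x₁ = r} (≤-trans x≤1+t t<S) j≤S j≤S r≤R (≤-trans y≤1+b b<R) (between-end x j)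
      ...   | p , tight , along , down , _ =
        no-three-∈≈ no-three p (tight⇒geodesic tight) a∈T b∈T t∈T a≉b
          (Distinct-sym (hEdge≉vEdge t<S j≤S)) (Distinct-sym (hEdge≉vEdge t<S j≤S))
          (down a a-step) (down b b-step) (along t (Sum.swap t-step))

      col-edge≡a⊎b : ∀ {k} → suc k ≤ suc R → vEdge j k ∈≈ T → k ≡ a ⊎ k ≡ b
      col-edge≡a⊎b {k} k<R k∈T with k ≟ a | k ≟ b
      ... | yes k≡a | _       = inj₁ k≡a
      ... | no _    | yes k≡b = inj₂ k≡b
      ... | no k≢a  | no k≢b with col-geodesic j≤S
      ...   | p , geo , on = ⊥-elim (no-three-∈≈ no-three p geo k∈T a∈T b∈T
                               (k≢a ∘ vEdge≈vEdge⇒≡ k<R a<R) a≉b (k≢b ∘ vEdge≈vEdge⇒≡ k<R b<R) (on k<R) (on a<R) (on b<R))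

      empty-col-beside : ∀ {r t} → a < r → r ≤ b → suc t ≤ suc S → hEdge r t ∈≈ T → Σ ℕ λ c → c ≤ suc S × colCount c ≡ 0
      empty-col-beside {r} {t} a<r r≤b t<S t∈T with far-end t j
      ... | c , c≤1+t , t-step , j≢c = c , c≤S , colCount≡0 none
        where
        c≤S = ≤-trans c≤1+t t<S
        r≤R = ≤-trans r≤b (<⇒≤ b<R)
        j≉c : ∀ {k k′} → Distinct (vEdge j k) (vEdge c k′)
        j≉c = j≢c ∘ vEdge≈vEdge⇒col≡ j≤S c≤S
        none : ∀ {k} → suc k ≤ suc R → ¬ (vEdge c k ∈≈ T)
        none {k} k<R k∈T with <-≤-connex k r
        ... | inj₂ r≤k with vhv-geodesic {y₁ = j} {y₂ = c} (<⇒≤ a<R) r≤R k<R j≤S c≤S (inj₁ (<⇒≤ a<r , ≤-trans r≤k (n≤1+n k)))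
        ...   | p , tight , down , along , down′ =
          no-three-∈≈ no-three p (tight⇒geodesic tight) a∈T t∈T k∈T (Distinct-sym (hEdge≉vEdge t<S j≤S)) (hEdge≉vEdge t<S c≤S) j≉c
            (down a (inj₁ (≤-refl , a<r))) (along t t-step) (down′ k (inj₁ (r≤k , ≤-refl)))
        none {k} k<R k∈T | inj₁ k<r
          with vhv-geodesic {y₁ = j} {y₂ = c} b<R r≤R (<⇒≤ k<R) j≤S c≤S (inj₂ (<⇒≤ k<r , ≤-trans r≤b (n≤1+n b)))
        ...   | p , tight , up , along , up′ =
          no-three-∈≈ no-three p (tight⇒geodesic tight) b∈T t∈T k∈T (Distinct-sym (hEdge≉vEdge t<S j≤S)) (hEdge≉vEdge t<S c≤S) j≉c
            (up b (inj₂ (r≤b , ≤-refl))) (along t t-step) (up′ k (inj₂ (≤-refl , k<r)))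

      empty-col : ∀ {r} → 1 ≤ rowCount r → Σ ℕ λ c → c ≤ suc S × colCount c ≡ 0
      empty-col {r} pos with count-pos⇒∃ (InRow? r) T pos
      ... | e , e∈ , e-row with inRow⇒hEdge (T-edge e∈) e-row | outside⊎inside r a b
      ...   | t , t<S , e≈ | inj₁ outside = ⊥-elim (no-horizontal-outside (InRow⇒≤R e e-row) t<S outside (lose e∈ (≈-sym e≈)))
      ...   | t , t<S , e≈ | inj₂ (a<r , r≤b) = empty-col-beside a<r r≤b t<S (lose e∈ (≈-sym e≈))

    nH nV : ℕ
    nH = ∑< (suc (suc R)) rowCount
    nV = ∑< (suc (suc S)) colCount

    length≡nH+nV : length T ≡ nH + nV
    length≡nH+nV = length≡∑rows+∑cols (proj₁ T-set)

    Saturated : Set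
    Saturated = (∀ {i} → 1 ≤ i → i ≤ R → 2 ≤ rowCount i) × (∀ {j} → 1 ≤ j → j ≤ S → 2 ≤ colCount j)

    outer-rows-empty : ∀ {j} → TwoInCol j → rowCount 0 ≡ 0 × rowCount (suc R) ≡ 0
    outer-rows-empty two = rowCount≡0 (λ t<S → no-horizontal-outside two z≤n t<S (inj₁ z≤n)) ,
                           rowCount≡0 (λ t<S → no-horizontal-outside two ≤-refl t<S (inj₂ (TwoInCol.b<R two)))

    outer-cols-empty : ∀ {i} → TwoInRow i → colCount 0 ≡ 0 × colCount (suc S) ≡ 0
    outer-cols-empty two = colCount≡0 (λ k<R → no-vertical-outside two z≤n k<R (inj₁ z≤n)) ,
                           colCount≡0 (λ k<R → no-vertical-outside two ≤-refl k<R (inj₂ (TwoInRow.b<S two)))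

    module _ (3≤R : 3 ≤ R) (3≤S : 3 ≤ S) where

      K : ℕ
      K = (R + R) + (S + S)

      Bounded : Set
      Bounded = length T ≤ K × (K ≤ length T → Saturated)

      private
        rows≤2 : ∀ i → i < suc (suc R) → rowCount i ≤ 2
        rows≤2 i _ = rowCount≤2 i

        cols≤2 : ∀ j → j < suc (suc S) → colCount j ≤ 2
        cols≤2 j _ = colCount≤2 j

        n*2≡n+n : ∀ n → n * 2 ≡ n + n
        n*2≡n+n n = trans (*-comm n 2) (cong (n +_) (+-identityʳ n))

        [2+n]*2≡4+[n+n] : ∀ n → suc (suc n) * 2 ≡ 4 + (n + n)
        [2+n]*2≡4+[n+n] n = cong (λ x → 2 + (2 + x)) (n*2≡n+n n)

        2+n<n+n : ∀ {n} → 3 ≤ n → 2 + n < n + n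
        2+n<n+n {n} 3≤n = +-monoˡ-< n 3≤n

        4<n+n : ∀ {n} → 3 ≤ n → 4 < n + n
        4<n+n 3≤n = ≤-trans (s≤s (s≤s (s≤s (s≤s (s≤s z≤n))))) (+-mono-≤ 3≤n 3≤n)

        strict : ∀ {h v} → nH ≤ h → nV ≤ v → h + v < K → Bounded
        strict nH≤h nV≤v h+v<K = ≤-trans (≤-reflexive length≡nH+nV) (<⇒≤ nH+nV<K) ,
                                 λ K≤ → ⊥-elim (<⇒≱ nH+nV<K (≤-trans K≤ (≤-reflexive length≡nH+nV)))
          where nH+nV<K = ≤-<-trans (+-mono-≤ nH≤h nV≤v) h+v<K

        both-pairs : ∀ {i j} → TwoInRow i → TwoInCol j → Bounded
        both-pairs row-two col-two = ≤-trans (≤-reflexive length≡nH+nV) (+-mono-≤ nH≤ nV≤) , saturated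
          where
          rows-ends = outer-rows-empty col-two
          cols-ends = outer-cols-empty row-two
          nH≤ : nH ≤ R + R
          nH≤ = ≤-trans (∑<-ends-zero R 2 rows≤2 (proj₁ rows-ends) (proj₂ rows-ends)) (≤-reflexive (n*2≡n+n R))
          nV≤ : nV ≤ S + S
          nV≤ = ≤-trans (∑<-ends-zero S 2 cols≤2 (proj₁ cols-ends) (proj₂ cols-ends)) (≤-reflexive (n*2≡n+n S))
          saturated : K ≤ length T → Saturated
          saturated K≤ = full-row , full-col
            where
            K≤nH+nV = ≤-trans K≤ (≤-reflexive length≡nH+nV)
            full-row : ∀ {i} → 1 ≤ i → i ≤ R → 2 ≤ rowCount i
            full-row {i} 1≤i i≤R with 2 ≤? rowCount i
            ... | yes 2≤ = 2≤
            ... | no 2≰ = ⊥-elim (<⇒≱ (+-mono-<-≤ nH<R+R nV≤) K≤nH+nV)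
              where
              nH<R+R = ≤-trans (∑<-ends-zero-gap R 2 rows≤2 (proj₁ rows-ends) (proj₂ rows-ends) 1≤i i≤R (≰⇒> 2≰))
                               (≤-reflexive (n*2≡n+n R))
            full-col : ∀ {j} → 1 ≤ j → j ≤ S → 2 ≤ colCount j
            full-col {j} 1≤j j≤S with 2 ≤? colCount j
            ... | yes 2≤ = 2≤
            ... | no 2≰ = ⊥-elim (<⇒≱ (+-mono-≤-< nH≤ nV<S+S) K≤nH+nV)
              where
              nV<S+S = ≤-trans (∑<-ends-zero-gap S 2 cols≤2 (proj₁ cols-ends) (proj₂ cols-ends) 1≤j j≤S (≰⇒> 2≰))
                               (≤-reflexive (n*2≡n+n S))

        rows-sparse : (∀ i → i < suc (suc R) → rowCount i ≤ 1) → ∀ {j} → TwoInCol j → Bounded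
        rows-sparse sparse col-two with 1 ≤? nH
        ... | no nH≱1 = strict (≤-pred (≰⇒> nH≱1)) nV≤ (+-monoˡ-< (S + S) (4<n+n 3≤R))
          where nV≤ = ≤-trans (∑<-≤-* (suc (suc S)) 2 cols≤2) (≤-reflexive ([2+n]*2≡4+[n+n] S))
        ... | yes 1≤nH with ∑<-positive (suc (suc R)) rowCount 1≤nH
        ...   | _ , _ , 1≤row with empty-col col-two 1≤row
        ...     | c , c≤S , col-empty = strict nH≤R nV≤ (≤-trans (≤-reflexive (cong suc (sym (+-assoc R 2 (S + S)))))
                                                                  (+-monoˡ-< (S + S) (+-monoʳ-< R 3≤R)))
          where
          rows-ends = outer-rows-empty col-two
          nH≤R : nH ≤ R
          nH≤R = ≤-trans (∑<-ends-zero R 1 sparse (proj₁ rows-ends) (proj₂ rows-ends)) (≤-reflexive (*-identityʳ R))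
          nV≤ : nV ≤ 2 + (S + S)
          nV≤ = +-cancelʳ-≤ 2 nV (2 + (S + S)) (≤-trans (∑<+b≤n*b (suc (suc S)) 2 cols≤2 (s≤s c≤S) col-empty)
                  (≤-reflexive (trans ([2+n]*2≡4+[n+n] S) (+-comm 2 (2 + (S + S))))))

        cols-sparse : (∀ j → j < suc (suc S) → colCount j ≤ 1) → ∀ {i} → TwoInRow i → Bounded
        cols-sparse sparse row-two with 1 ≤? nV
        ... | no nV≱1 = strict nH≤ (≤-pred (≰⇒> nV≱1))
                          (≤-trans (≤-reflexive (cong suc (trans (+-identityʳ _) (+-comm 4 (R + R))))) (+-monoʳ-< (R + R) (4<n+n 3≤S)))
          where nH≤ = ≤-trans (∑<-≤-* (suc (suc R)) 2 rows≤2) (≤-reflexive ([2+n]*2≡4+[n+n] R))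
        ... | yes 1≤nV with ∑<-positive (suc (suc S)) colCount 1≤nV
        ...   | _ , _ , 1≤col with empty-row row-two 1≤col
        ...     | r , r≤R , row-empty = strict nH≤ nV≤S (≤-trans (≤-reflexive (cong suc rearrange))
                                                                (+-monoʳ-< (R + R) (2+n<n+n 3≤S)))
          where
          cols-ends = outer-cols-empty row-two
          nV≤S : nV ≤ S
          nV≤S = ≤-trans (∑<-ends-zero S 1 sparse (proj₁ cols-ends) (proj₂ cols-ends)) (≤-reflexive (*-identityʳ S))
          nH≤ : nH ≤ 2 + (R + R)
          nH≤ = +-cancelʳ-≤ 2 nH (2 + (R + R)) (≤-trans (∑<+b≤n*b (suc (suc R)) 2 rows≤2 (s≤s r≤R) row-empty)
                  (≤-reflexive (trans ([2+n]*2≡4+[n+n] R) (+-comm 2 (2 + (R + R))))))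
          rearrange : 2 + (R + R) + S ≡ R + R + (2 + S)
          rearrange = trans (cong (_+ S) (+-comm 2 (R + R))) (+-assoc (R + R) 2 S)

        all-sparse : (∀ i → i < suc (suc R) → rowCount i ≤ 1) → (∀ j → j < suc (suc S) → colCount j ≤ 1) → Bounded
        all-sparse rows≤1 cols≤1 = strict nH≤ nV≤ (+-mono-<-≤ (2+n<n+n 3≤R) (<⇒≤ (2+n<n+n 3≤S)))
          where
          nH≤ = ≤-trans (∑<-≤-* (suc (suc R)) 1 rows≤1) (≤-reflexive (cong (2 +_) (*-identityʳ R)))
          nV≤ = ≤-trans (∑<-≤-* (suc (suc S)) 1 cols≤1) (≤-reflexive (cong (2 +_) (*-identityʳ S)))

      bounded : Bounded
      bounded with all≤1⊎some≥2 (suc (suc R)) rowCount | all≤1⊎some≥2 (suc (suc S)) colCount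
      ... | inj₂ (_ , _ , row≥2) | inj₂ (_ , _ , col≥2) = both-pairs (twoInRow row≥2) (twoInCol col≥2)
      ... | inj₁ rows≤1          | inj₂ (_ , _ , col≥2) = rows-sparse rows≤1 (twoInCol col≥2)
      ... | inj₂ (_ , _ , row≥2) | inj₁ cols≤1          = cols-sparse cols≤1 (twoInRow row≥2)
      ... | inj₁ rows≤1          | inj₁ cols≤1          = all-sparse rows≤1 cols≤1

    module _ (saturated : Saturated) (1≤R : 1 ≤ R) (1≤S : 1 ≤ S) where

      private
        row-pair : ∀ {i} → 1 ≤ i → i ≤ R → TwoInRow i
        row-pair 1≤i i≤R = twoInRow (proj₁ saturated 1≤i i≤R)

        col-pair : ∀ {j} → 1 ≤ j → j ≤ S → TwoInCol j
        col-pair 1≤j j≤S = twoInCol (proj₂ saturated 1≤j j≤S)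

        -- a pair in a row must sit at the two ends, since every inner column carries an edge
        row-pair-ends : ∀ {i} (two : TwoInRow i) → TwoInRow.a two ≡ 0 × TwoInRow.b two ≡ S
        row-pair-ends two = a≡0 , b≡S
          where
          open TwoInRow two
          inner-inside : ∀ {c} → c ≤ a ⊎ b < c → 1 ≤ c → c ≤ S → ⊥
          inner-inside outside 1≤c c≤S = <⇒≱ (proj₂ saturated 1≤c c≤S)
            (≤-trans (≤-reflexive (colCount≡0 (λ k<R → no-vertical-outside two (m≤n⇒m≤1+n c≤S) k<R outside))) z≤n)
          a≡0 : a ≡ 0
          a≡0 with 1 ≤? a
          ... | yes 1≤a = ⊥-elim (inner-inside (inj₁ ≤-refl) 1≤a (≤-pred (<-trans a<b b<S)))
          ... | no a≱1  = n≤0⇒n≡0 (≤-pred (≰⇒> a≱1))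
          b≡S : b ≡ S
          b≡S with suc b ≤? S
          ... | yes b<S′ = ⊥-elim (inner-inside (inj₂ ≤-refl) (s≤s z≤n) b<S′)
          ... | no b≮S   = ≤-antisym (≤-pred b<S) (≤-pred (≰⇒> b≮S))

        col-pair-ends : ∀ {j} (two : TwoInCol j) → TwoInCol.a two ≡ 0 × TwoInCol.b two ≡ R
        col-pair-ends two = a≡0 , b≡R
          where
          open TwoInCol two
          inner-inside : ∀ {r} → r ≤ a ⊎ b < r → 1 ≤ r → r ≤ R → ⊥
          inner-inside outside 1≤r r≤R = <⇒≱ (proj₁ saturated 1≤r r≤R)
            (≤-trans (≤-reflexive (rowCount≡0 (λ t<S → no-horizontal-outside two (m≤n⇒m≤1+n r≤R) t<S outside))) z≤n)
          a≡0 : a ≡ 0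
          a≡0 with 1 ≤? a
          ... | yes 1≤a = ⊥-elim (inner-inside (inj₁ ≤-refl) 1≤a (≤-pred (<-trans a<b b<R)))
          ... | no a≱1  = n≤0⇒n≡0 (≤-pred (≰⇒> a≱1))
          b≡R : b ≡ R
          b≡R with suc b ≤? R
          ... | yes b<R′ = ⊥-elim (inner-inside (inj₂ ≤-refl) (s≤s z≤n) b<R′)
          ... | no b≮R   = ≤-antisym (≤-pred b<R) (≤-pred (≰⇒> b≮R))

        inner-row : ∀ {j} (two : TwoInCol j) → ∀ {i t} → i ≤ suc R → suc t ≤ suc S → hEdge i t ∈≈ T → 1 ≤ i × i ≤ R
        inner-row two {i} i≤1+R t<S t∈T with outside⊎inside i (TwoInCol.a two) (TwoInCol.b two) | col-pair-ends two
        ... | inj₁ outside     | _         = ⊥-elim (no-horizontal-outside two i≤1+R t<S outside t∈T)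
        ... | inj₂ (a<i , i≤b) | a≡0 , b≡R = subst (_< i) a≡0 a<i , subst (i ≤_) b≡R i≤b

        inner-col : ∀ {i} (two : TwoInRow i) → ∀ {j k} → j ≤ suc S → suc k ≤ suc R → vEdge j k ∈≈ T → 1 ≤ j × j ≤ S
        inner-col two {j} j≤1+S k<R k∈T with outside⊎inside j (TwoInRow.a two) (TwoInRow.b two) | row-pair-ends two
        ... | inj₁ outside     | _         = ⊥-elim (no-vertical-outside two j≤1+S k<R outside k∈T)
        ... | inj₂ (a<j , j≤b) | a≡0 , b≡S = subst (_< j) a≡0 a<j , subst (j ≤_) b≡S j≤b

        row-spoke : ∀ {i} (two : TwoInRow i) → 1 ≤ i → i ≤ R → ∀ {t} → suc t ≤ suc S → hEdge i t ∈≈ T → IsSpoke (hEdge i t)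
        row-spoke {i} two 1≤i i≤R t<S t∈T with row-pair-ends two | row-edge≡a⊎b two t<S t∈T
        ... | a≡0 , _ | inj₁ t≡a = subst (IsSpoke ∘ hEdge i) (sym (trans t≡a a≡0)) (left 1≤i i≤R)
        ... | _ , b≡S | inj₂ t≡b = subst (IsSpoke ∘ hEdge i) (sym (trans t≡b b≡S)) (right 1≤i i≤R)

        col-spoke : ∀ {j} (two : TwoInCol j) → 1 ≤ j → j ≤ S → ∀ {k} → suc k ≤ suc R → vEdge j k ∈≈ T → IsSpoke (vEdge j k)
        col-spoke {j} two 1≤j j≤S k<R k∈T with col-pair-ends two | col-edge≡a⊎b two k<R k∈T
        ... | a≡0 , _ | inj₁ k≡a = subst (IsSpoke ∘ vEdge j) (sym (trans k≡a a≡0)) (top 1≤j j≤S)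
        ... | _ , b≡R | inj₂ k≡b = subst (IsSpoke ∘ vEdge j) (sym (trans k≡b b≡R)) (bottom 1≤j j≤S)

        horizontal-spoke : ∀ {i t} → i ≤ suc R → suc t ≤ suc S → hEdge i t ∈≈ T → IsSpoke (hEdge i t)
        horizontal-spoke i≤1+R t<S t∈T =
          let (1≤i , i≤R) = inner-row (col-pair 1≤S ≤-refl) i≤1+R t<S t∈T in row-spoke (row-pair 1≤i i≤R) 1≤i i≤R t<S t∈T

        vertical-spoke : ∀ {j k} → j ≤ suc S → suc k ≤ suc R → vEdge j k ∈≈ T → IsSpoke (vEdge j k)
        vertical-spoke j≤1+S k<R k∈T =
          let (1≤j , j≤S) = inner-col (row-pair 1≤R ≤-refl) j≤1+S k<R k∈T in col-spoke (col-pair 1≤j j≤S) 1≤j j≤S k<R k∈T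

        ∈T⇒∈≈spokes : ∀ {e} → e ∈ T → e ∈≈ spokes
        ∈T⇒∈≈spokes {e@(u , v)} e∈ with T-edge e∈
        ... | inj₁ (_ , u≡v) = let (k , k<R , e≈) = inCol⇒vEdge (T-edge e∈) (refl , cong toℕ (sym u≡v)) in
          lose (IsSpoke⇒∈spokes (vertical-spoke (col≤S u) k<R (lose e∈ (≈-sym e≈)))) e≈
        ... | inj₂ (u≡v , _) = let (t , t<S , e≈) = inRow⇒hEdge (T-edge e∈) (refl , cong toℕ (sym u≡v)) in
          lose (IsSpoke⇒∈spokes (horizontal-spoke (row≤R u) t<S (lose e∈ (≈-sym e≈)))) e≈

        spoke∈≈T : ∀ {e} → IsSpoke e → e ∈≈ T
        spoke∈≈T (top 1≤j j≤S)    = subst (λ k → vEdge _ k ∈≈ T) (proj₁ (col-pair-ends two)) (TwoInCol.a∈T two)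
          where two = col-pair 1≤j j≤S
        spoke∈≈T (bottom 1≤j j≤S) = subst (λ k → vEdge _ k ∈≈ T) (proj₂ (col-pair-ends two)) (TwoInCol.b∈T two)
          where two = col-pair 1≤j j≤S
        spoke∈≈T (left 1≤i i≤R)   = subst (λ t → hEdge _ t ∈≈ T) (proj₁ (row-pair-ends two)) (TwoInRow.a∈T two)
          where two = row-pair 1≤i i≤R
        spoke∈≈T (right 1≤i i≤R)  = subst (λ t → hEdge _ t ∈≈ T) (proj₂ (row-pair-ends two)) (TwoInRow.b∈T two)
          where two = row-pair 1≤i i≤R

      ∈≈T⇔∈≈spokes : ∀ e → e ∈≈ T ⇔ e ∈≈ spokes
      ∈≈T⇔∈≈spokes e = mk⇔
        (λ e∈T → let (_ , f∈ , e≈f) = find e∈T in ∈≈-resp-≈ e≈f (∈T⇒∈≈spokes f∈))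
        (λ e∈S → let (_ , s∈ , e≈s) = find e∈S in ∈≈-resp-≈ e≈s (spoke∈≈T (∈spokes⇒IsSpoke s∈)))

theorem4p2 : (r s : ℕ) → 5 ≤ r → 5 ≤ s → UniqueMaxEdgeGP (P r □ P s)
theorem4p2 (suc (suc R)) (suc (suc S)) (s≤s (s≤s 3≤R)) (s≤s (s≤s 3≤S)) =
  spokes , (spokes-edgeSet 1≤R 1≤S , spokes-edgeGP 1≤R 1≤S , maximum) , unique
  where
  open Spokes R S

  1≤R : 1 ≤ R
  1≤R = ≤-trans (s≤s z≤n) 3≤R

  1≤S : 1 ≤ S
  1≤S = ≤-trans (s≤s z≤n) 3≤S

  maximum : ∀ T → IsEdgeSet G T → IsEdgeGP G T → length T ≤ length spokes
  maximum T T-set T-gp = ≤-trans (proj₁ (Bound.bounded T-set T-gp 3≤R 3≤S)) (≤-reflexive (sym length-spokes))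

  unique : ∀ T → IsMaxEdgeGP G T → ∀ e → e ∈≈ T ⇔ e ∈≈ spokes
  unique T (T-set , T-gp , T-max) = Bound.∈≈T⇔∈≈spokes T-set T-gp saturated 1≤R 1≤S
    where
    saturated : Bound.Saturated T-set T-gp
    saturated = proj₂ (Bound.bounded T-set T-gp 3≤R 3≤S)
      (≤-trans (≤-reflexive (sym length-spokes)) (T-max spokes (spokes-edgeSet 1≤R 1≤S) (spokes-edgeGP 1≤R 1≤S)))
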